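{- For all positive integers $l$, $m$, $n$, $r$ and every integer $j$ with $0\leq j\leq 3r-1$, $${l+n\brack n}^{ -1}\sum_{k=-l}^l(-1)^kq^{jk^2+\binom{k}{2}}{l+m\brack l+k}^r{m+n\brack m+k}^r{n+l\brack n+k}^r$$ is a polynomial in $q$ with nonnegative integer coefficients. In particular, $\sum_{k=-l}^l(-1)^k\binom{l+m}{l+k}^r\binom{m+n}{m+k}^r\binom{n+l}{n+k}^r$ is divisible by each of $\binom{l+m}{l}$, $\binom{m+n}{m}$ and $\binom{n+l}{n}$.
   Context: For an integer $n\ge 0$, $(q)_n=(1-q)(1-q^2)\cdots(1-q^n)$ (with $(q)_0=1$). The $q$-binomial coefficient is ${n\brack k}=\frac{(q)_n}{(q)_k(q)_{n-k}}$ for $0\le k\le n$, and $0$ otherwise; likewise ordinary binomial coefficients $\binom{a}{b}$ are $0$ when $b<0$ or $b>a$. -}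

module Defs where

open import Data.Nat as ℕ using (ℕ; zero; suc)
open import Data.Nat.Combinatorics using (_C_)
open import Data.Integer as ℤ using (ℤ; +_; -[1+_]; ∣_∣)
open import Data.List using (List; []; _∷_; map; replicate; _++_; foldr; upTo)
open import Relation.Binary.PropositionalEquality using (_≡_)

-- Polynomials in q with integer coefficients, as coefficient lists
-- (constant term first).
Poly : Set
Poly = List ℤ

coeff : Poly → ℕ → ℤ
coeff []       _       = + 0
coeff (a ∷ _)  zero    = a
coeff (_ ∷ p)  (suc i) = coeff p i

-- equality of polynomials: all coefficients agree (trailing zeros ignored)
infix 4 _≈_
_≈_ : Poly → Poly → Set
p ≈ p′ = ∀ i → coeff p i ≡ coeff p′ i

infixl 6 _⊕_
_⊕_ : Poly → Poly → Poly
[]      ⊕ p′       = p′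
(a ∷ p) ⊕ []       = a ∷ p
(a ∷ p) ⊕ (b ∷ p′) = (a ℤ.+ b) ∷ (p ⊕ p′)

scale : ℤ → Poly → Poly
scale c = map (c ℤ.*_)

infixl 7 _⊗_
_⊗_ : Poly → Poly → Poly
[]      ⊗ _  = []
(a ∷ p) ⊗ p′ = scale a p′ ⊕ (+ 0 ∷ (p ⊗ p′))

shift : ℕ → Poly → Poly
shift e p = replicate e (+ 0) ++ p

one : Poly
one = + 1 ∷ []

infixr 8 _^ᵖ_
_^ᵖ_ : Poly → ℕ → Poly
p ^ᵖ zero  = one
p ^ᵖ suc r = p ⊗ (p ^ᵖ r)

qbin : ℕ → ℕ → Poly
qbin _       zero    = one
qbin zero    (suc k) = []
qbin (suc n) (suc k) = qbin n k ⊕ shift (suc k) (qbin n (suc k))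

-- [n, k] for integer k (zero when k < 0; zero when k > n by the recursion)
qbinℤ : ℕ → ℤ → Poly
qbinℤ n (+ k)    = qbin n k
qbinℤ n -[1+ _ ] = []

binℤ : ℕ → ℤ → ℤ
binℤ n (+ k)    = + (n C k)
binℤ n -[1+ _ ] = + 0

-- binom(k, 2) = k(k-1)/2 for integer k (always a natural number)
choose2 : ℤ → ℕ
choose2 (+ a)      = a C 2
choose2 -[1+ a ]   = suc (suc a) C 2     -- (-(a+1))(-(a+2))/2

sgn : ℤ → ℤ
sgn k = (ℤ.- (+ 1)) ℤ.^ ∣ k ∣

Σsym : {A : Set} → (A → A → A) → A → ℕ → (ℤ → A) → A
Σsym _+_ z l f = foldr (λ i acc → f ((+ i) ℤ.- (+ l)) + acc) z (upTo (suc (2 ℕ.* l)))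

polySum : ℕ → (ℤ → Poly) → Poly
polySum = Σsym _⊕_ []

intSum : ℕ → (ℤ → ℤ) → ℤ
intSum = Σsym ℤ._+_ (+ 0)

qSum : ℕ → ℕ → ℕ → ℕ → ℕ → Poly
qSum l m n r j = polySum l λ k →
  shift (j ℕ.* (∣ k ∣ ℕ.* ∣ k ∣) ℕ.+ choose2 k)
    (scale (sgn k)
      ((qbinℤ (l ℕ.+ m) (+ l ℤ.+ k) ^ᵖ r)
        ⊗ (qbinℤ (m ℕ.+ n) (+ m ℤ.+ k) ^ᵖ r)
        ⊗ (qbinℤ (n ℕ.+ l) (+ n ℤ.+ k) ^ᵖ r)))

iSum : ℕ → ℕ → ℕ → ℕ → ℤ
iSum l m n r = intSum l λ k →
  sgn k ℤ.* ((binℤ (l ℕ.+ m) (+ l ℤ.+ k) ℤ.^ r)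
           ℤ.* (binℤ (m ℕ.+ n) (+ m ℤ.+ k) ℤ.^ r)
           ℤ.* (binℤ (n ℕ.+ l) (+ n ℤ.+ k) ℤ.^ r))

-- Write [x+y, x+k] = qbinᶜ x y k, so that the k-th summand is a product of
-- centred q-binomials along the cycle l → m → n → l → ⋯ that winds r times
-- round the triangle.  Expanding [a+b, a+κ] by q-Vandermonde and revising
-- products of q-binomials with q-trinomial identities, the three factors on
-- a path v → a → b → u contract to
--   Σ_{s ≤ min(a,b)} w(s) [b+u, b−s] [v+a, a−s] · [s+u, s+k] [v+s, v+k],
-- where w(s) is a power of q; with the second expansion w(s) = q^(s²) and a
-- factor q^(k²) is absorbed.  After 3r − 2 contractions a 2-cycle is left,
-- which contracts in the same way to Σ_s c(s) [2s, s+k], absorbing one more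
-- q^(k²); hence j ≤ 3r − 1.  Finally Σ_k (-1)^k q^C(k,2) [2s, s+k] vanishes
-- for s > 0, so only s = 0 survives, and what is left is [l+n, n] times a
-- sum of products of q-binomials and powers of q.  At q = 1 this gives
-- divisibility by C(l+n, n); the sum is invariant under rotating (l, m, n),
-- which gives the other two binomials.

module Submission where

open import Defs
open import Algebra.Bundles using (CommutativeRing)
open import Algebra.Structures using (IsCommutativeRing)
open import Data.Bool using (Bool; true; false)
open import Data.Empty using (⊥-elim)
open import Data.Integer as ℤ using (ℤ; +_; -[1+_]; ∣_∣; _⊖_; 0ℤ; +≤+)
  renaming (_+_ to _+ℤ_; _*_ to _*ℤ_; _≤_ to _≤ℤ_)
import Data.Integer.Properties as ℤP
open import Algebra.Properties.CommutativeSemigroup ℤP.+-commutativeSemigroup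
  using () renaming (interchange to +-interchange)
open import Data.Integer.Divisibility using (_∣_)
import Data.Integer.Divisibility.Signed as Signed
import Data.Integer.Tactic.RingSolver as ℤ-Solver
open import Data.List using (List; []; _∷_; applyUpTo; foldr; length; map; upTo)
open import Data.List.Properties using (foldr-fusion; foldr-cong)
open import Data.Maybe using (Maybe; nothing; just)
open import Data.Nat as ℕ using (ℕ; zero; suc; _+_; _*_; _∸_; _⊓_; _≤_; _<_; z≤n; s≤s; pred; _<ᵇ_)
open import Data.Nat.Combinatorics using (_C_; nCk+nC[k+1]≡[n+1]C[k+1]; nC1≡n)
import Data.Nat.Properties as ℕP
open import Algebra.Definitions.RawMagma ℕ.+-rawMagma using (_,_)
import Data.Nat.Tactic.RingSolver as ℕ-Solver
open import Data.Product using (Σ; _×_; _,_)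
open import Data.Sum using (_⊎_; inj₁; inj₂)
open import Function using (_∘_; id)
open import Relation.Binary.Bundles using (Setoid)
open import Relation.Binary.PropositionalEquality
import Relation.Binary.Reasoning.Setoid as SetoidReasoning
open import Relation.Nullary using (yes; no)
open import Tactic.RingSolver using (solve-∀)
import Tactic.RingSolver.Core.AlmostCommutativeRing as ACR

-- The polynomial ring

-- p ≈ r unfolds to a Π-type from which Agda cannot infer p and r;
-- wrapping it in a record makes both arguments inferable.
infix 4 _≋_
record _≋_ (p r : Poly) : Set where
  constructor mk
  field coeff-≡ : p ≈ r
open _≋_ public

≋-refl : ∀ {p} → p ≋ p
≋-refl = mk λ _ → refl

≋-sym : ∀ {p r} → p ≋ r → r ≋ p
≋-sym (mk e) = mk λ i → sym (e i)

≋-trans : ∀ {p r t} → p ≋ r → r ≋ t → p ≋ t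
≋-trans (mk e) (mk f) = mk λ i → trans (e i) (f i)

≡⇒≋ : ∀ {p r} → p ≡ r → p ≋ r
≡⇒≋ refl = ≋-refl

≋-setoid : Setoid _ _
≋-setoid = record
  { Carrier = Poly ; _≈_ = _≋_
  ; isEquivalence = record { refl = ≋-refl ; sym = ≋-sym ; trans = ≋-trans } }

module ≋-Reasoning = SetoidReasoning ≋-setoid

∷-cong : ∀ {a b p r} → a ≡ b → p ≋ r → (a ∷ p) ≋ (b ∷ r)
∷-cong e (mk f) = mk λ { zero → e ; (suc i) → f i }

∷-injectiveˡ : ∀ {a b p r} → (a ∷ p) ≋ (b ∷ r) → a ≡ b
∷-injectiveˡ (mk e) = e zero

∷-injectiveʳ : ∀ {a b p r} → (a ∷ p) ≋ (b ∷ r) → p ≋ r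
∷-injectiveʳ (mk e) = mk λ i → e (suc i)

∷-zero-tail : ∀ {a p} → (a ∷ p) ≋ [] → p ≋ []
∷-zero-tail (mk e) = mk λ i → e (suc i)

0∷-zero : ∀ {p} → p ≋ [] → (+ 0 ∷ p) ≋ []
0∷-zero (mk e) = mk λ { zero → refl ; (suc i) → e i }

coeff-⊕ : ∀ p r i → coeff (p ⊕ r) i ≡ coeff p i +ℤ coeff r i
coeff-⊕ []      r       i       = sym (ℤP.+-identityˡ _)
coeff-⊕ (a ∷ p) []      i       = sym (ℤP.+-identityʳ _)
coeff-⊕ (a ∷ p) (b ∷ r) zero    = refl
coeff-⊕ (a ∷ p) (b ∷ r) (suc i) = coeff-⊕ p r i

coeff-scale : ∀ c p i → coeff (scale c p) i ≡ c *ℤ coeff p i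
coeff-scale c []      i       = sym (ℤP.*-zeroʳ c)
coeff-scale c (a ∷ p) zero    = refl
coeff-scale c (a ∷ p) (suc i) = coeff-scale c p i

⊕-cong : ∀ {p p′ r r′} → p ≋ p′ → r ≋ r′ → (p ⊕ r) ≋ (p′ ⊕ r′)
⊕-cong {p} {p′} {r} {r′} (mk e) (mk f) = mk λ i → begin
  coeff (p ⊕ r) i           ≡⟨ coeff-⊕ p r i ⟩
  coeff p i +ℤ coeff r i    ≡⟨ cong₂ _+ℤ_ (e i) (f i) ⟩
  coeff p′ i +ℤ coeff r′ i  ≡⟨ coeff-⊕ p′ r′ i ⟨
  coeff (p′ ⊕ r′) i         ∎
  where open ≡-Reasoning

⊕-congˡ : ∀ {p p′} r → p ≋ p′ → (p ⊕ r) ≋ (p′ ⊕ r)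
⊕-congˡ r e = ⊕-cong e (≋-refl {r})

⊕-congʳ : ∀ p {r r′} → r ≋ r′ → (p ⊕ r) ≋ (p ⊕ r′)
⊕-congʳ p e = ⊕-cong (≋-refl {p}) e

⊕-comm : ∀ p r → (p ⊕ r) ≋ (r ⊕ p)
⊕-comm p r = mk λ i → begin
  coeff (p ⊕ r) i         ≡⟨ coeff-⊕ p r i ⟩
  coeff p i +ℤ coeff r i  ≡⟨ ℤP.+-comm (coeff p i) (coeff r i) ⟩
  coeff r i +ℤ coeff p i  ≡⟨ coeff-⊕ r p i ⟨
  coeff (r ⊕ p) i         ∎
  where open ≡-Reasoning

⊕-assoc : ∀ p r t → ((p ⊕ r) ⊕ t) ≋ (p ⊕ (r ⊕ t))
⊕-assoc p r t = mk λ i → begin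
  coeff ((p ⊕ r) ⊕ t) i                  ≡⟨ coeff-⊕ (p ⊕ r) t i ⟩
  coeff (p ⊕ r) i +ℤ coeff t i           ≡⟨ cong (_+ℤ coeff t i) (coeff-⊕ p r i) ⟩
  coeff p i +ℤ coeff r i +ℤ coeff t i    ≡⟨ ℤP.+-assoc (coeff p i) _ _ ⟩
  coeff p i +ℤ (coeff r i +ℤ coeff t i)  ≡⟨ cong (coeff p i +ℤ_) (coeff-⊕ r t i) ⟨
  coeff p i +ℤ coeff (r ⊕ t) i           ≡⟨ coeff-⊕ p (r ⊕ t) i ⟨
  coeff (p ⊕ (r ⊕ t)) i                  ∎
  where open ≡-Reasoning

⊕-identityʳ : ∀ p → (p ⊕ []) ≋ p
⊕-identityʳ []      = ≋-refl
⊕-identityʳ (a ∷ p) = ≋-refl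

scale-cong : ∀ c {p r} → p ≋ r → scale c p ≋ scale c r
scale-cong c {p} {r} (mk e) = mk λ i →
  trans (coeff-scale c p i) (trans (cong (c *ℤ_) (e i)) (sym (coeff-scale c r i)))

scale-⊕ : ∀ c p r → scale c (p ⊕ r) ≋ (scale c p ⊕ scale c r)
scale-⊕ c p r = mk λ i → begin
  coeff (scale c (p ⊕ r)) i                   ≡⟨ coeff-scale c (p ⊕ r) i ⟩
  c *ℤ coeff (p ⊕ r) i                        ≡⟨ cong (c *ℤ_) (coeff-⊕ p r i) ⟩
  c *ℤ (coeff p i +ℤ coeff r i)               ≡⟨ ℤP.*-distribˡ-+ c _ _ ⟩
  c *ℤ coeff p i +ℤ c *ℤ coeff r i            ≡⟨ cong₂ _+ℤ_ (coeff-scale c p i) (coeff-scale c r i) ⟨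
  coeff (scale c p) i +ℤ coeff (scale c r) i  ≡⟨ coeff-⊕ (scale c p) (scale c r) i ⟨
  coeff (scale c p ⊕ scale c r) i             ∎
  where open ≡-Reasoning

scale-distribʳ : ∀ c d p → scale (c +ℤ d) p ≋ (scale c p ⊕ scale d p)
scale-distribʳ c d p = mk λ i → begin
  coeff (scale (c +ℤ d) p) i                  ≡⟨ coeff-scale (c +ℤ d) p i ⟩
  (c +ℤ d) *ℤ coeff p i                       ≡⟨ ℤP.*-distribʳ-+ (coeff p i) c d ⟩
  c *ℤ coeff p i +ℤ d *ℤ coeff p i            ≡⟨ cong₂ _+ℤ_ (coeff-scale c p i) (coeff-scale d p i) ⟨
  coeff (scale c p) i +ℤ coeff (scale d p) i  ≡⟨ coeff-⊕ (scale c p) (scale d p) i ⟨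
  coeff (scale c p ⊕ scale d p) i             ∎
  where open ≡-Reasoning

scale-* : ∀ c d p → scale (c *ℤ d) p ≋ scale c (scale d p)
scale-* c d p = mk λ i → begin
  coeff (scale (c *ℤ d) p) i     ≡⟨ coeff-scale (c *ℤ d) p i ⟩
  c *ℤ d *ℤ coeff p i            ≡⟨ ℤP.*-assoc c d _ ⟩
  c *ℤ (d *ℤ coeff p i)          ≡⟨ cong (c *ℤ_) (coeff-scale d p i) ⟨
  c *ℤ coeff (scale d p) i       ≡⟨ coeff-scale c (scale d p) i ⟨
  coeff (scale c (scale d p)) i  ∎
  where open ≡-Reasoning

scale-zero : ∀ p → scale (+ 0) p ≋ []
scale-zero p = mk λ i → trans (coeff-scale (+ 0) p i) (ℤP.*-zeroˡ (coeff p i))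

scale-identity : ∀ p → scale (+ 1) p ≋ p
scale-identity p = mk λ i → trans (coeff-scale (+ 1) p i) (ℤP.*-identityˡ _)

⊕-interchange : ∀ a b c d → ((a ⊕ b) ⊕ (c ⊕ d)) ≋ ((a ⊕ c) ⊕ (b ⊕ d))
⊕-interchange a b c d = mk λ i → begin
  coeff ((a ⊕ b) ⊕ (c ⊕ d)) i                           ≡⟨ coeff-⊕ (a ⊕ b) (c ⊕ d) i ⟩
  coeff (a ⊕ b) i +ℤ coeff (c ⊕ d) i                    ≡⟨ cong₂ _+ℤ_ (coeff-⊕ a b i) (coeff-⊕ c d i) ⟩
  (coeff a i +ℤ coeff b i) +ℤ (coeff c i +ℤ coeff d i)  ≡⟨ +-interchange (coeff a i) _ _ _ ⟩
  (coeff a i +ℤ coeff c i) +ℤ (coeff b i +ℤ coeff d i)  ≡⟨ cong₂ _+ℤ_ (coeff-⊕ a c i) (coeff-⊕ b d i) ⟨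
  coeff (a ⊕ c) i +ℤ coeff (b ⊕ d) i                    ≡⟨ coeff-⊕ (a ⊕ c) (b ⊕ d) i ⟨
  coeff ((a ⊕ c) ⊕ (b ⊕ d)) i                           ∎
  where open ≡-Reasoning

⊗-vanishˡ : ∀ {p} r → p ≋ [] → (p ⊗ r) ≋ []
⊗-vanishˡ {[]}    r e = ≋-refl
⊗-vanishˡ {a ∷ p} r e = ≋-trans
  (⊕-cong (≋-trans (≡⇒≋ (cong (λ c → scale c r) (coeff-≡ e 0))) (scale-zero r))
          (∷-cong refl (⊗-vanishˡ r (∷-zero-tail e))))
  (0∷-zero ≋-refl)

⊗-congˡ : ∀ {p p′} r → p ≋ p′ → (p ⊗ r) ≋ (p′ ⊗ r)
⊗-congˡ {[]}    {p′}     r e = ≋-sym (⊗-vanishˡ r (≋-sym e))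
⊗-congˡ {a ∷ p} {[]}     r e = ⊗-vanishˡ r e
⊗-congˡ {a ∷ p} {b ∷ p′} r e =
  ⊕-cong (≡⇒≋ (cong (λ c → scale c r) (∷-injectiveˡ e))) (∷-cong refl (⊗-congˡ r (∷-injectiveʳ e)))

⊗-congʳ : ∀ p {r r′} → r ≋ r′ → (p ⊗ r) ≋ (p ⊗ r′)
⊗-congʳ []      e = ≋-refl
⊗-congʳ (a ∷ p) e = ⊕-cong (scale-cong a e) (∷-cong refl (⊗-congʳ p e))

⊗-cong : ∀ {p p′ r r′} → p ≋ p′ → r ≋ r′ → (p ⊗ r) ≋ (p′ ⊗ r′)
⊗-cong {p′ = p′} {r} e f = ≋-trans (⊗-congˡ r e) (⊗-congʳ p′ f)

⊗-distribʳ : ∀ p p′ r → ((p ⊕ p′) ⊗ r) ≋ ((p ⊗ r) ⊕ (p′ ⊗ r))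
⊗-distribʳ []      p′       r = ≋-refl
⊗-distribʳ (a ∷ p) []       r = ≋-sym (⊕-identityʳ _)
⊗-distribʳ (a ∷ p) (b ∷ p′) r = ≋-trans
  (⊕-cong (scale-distribʳ a b r) (∷-cong refl (⊗-distribʳ p p′ r)))
  (⊕-interchange (scale a r) (scale b r) (+ 0 ∷ (p ⊗ r)) (+ 0 ∷ (p′ ⊗ r)))

⊗-distribˡ : ∀ p r r′ → (p ⊗ (r ⊕ r′)) ≋ ((p ⊗ r) ⊕ (p ⊗ r′))
⊗-distribˡ []      r r′ = ≋-refl
⊗-distribˡ (a ∷ p) r r′ = ≋-trans
  (⊕-cong (scale-⊕ a r r′) (∷-cong refl (⊗-distribˡ p r r′)))
  (⊕-interchange (scale a r) (scale a r′) (+ 0 ∷ (p ⊗ r)) (+ 0 ∷ (p ⊗ r′)))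

⊗-zeroʳ : ∀ p → (p ⊗ []) ≋ []
⊗-zeroʳ []      = ≋-refl
⊗-zeroʳ (a ∷ p) = 0∷-zero (⊗-zeroʳ p)

⊗-vanishʳ : ∀ p {r} → r ≋ [] → (p ⊗ r) ≋ []
⊗-vanishʳ p r≋[] = ≋-trans (⊗-congʳ p r≋[]) (⊗-zeroʳ p)

0∷-⊗ : ∀ p r → ((+ 0 ∷ p) ⊗ r) ≋ (+ 0 ∷ (p ⊗ r))
0∷-⊗ p r = ⊕-cong (scale-zero r) ≋-refl

scale-⊗ : ∀ c p r → (scale c p ⊗ r) ≋ scale c (p ⊗ r)
scale-⊗ c []      r = ≋-refl
scale-⊗ c (a ∷ p) r = ≋-trans
  (⊕-cong (scale-* c a r) (∷-cong (sym (ℤP.*-zeroʳ c)) (scale-⊗ c p r)))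
  (≋-sym (scale-⊕ c (scale a r) (+ 0 ∷ (p ⊗ r))))

⊗-∷ : ∀ p b r → (p ⊗ (b ∷ r)) ≋ (scale b p ⊕ (+ 0 ∷ (p ⊗ r)))
⊗-∷ []      b r = mk λ { zero → refl ; (suc i) → refl }
⊗-∷ (a ∷ p) b r = ∷-cong
  (trans (ℤP.+-identityʳ _) (trans (ℤP.*-comm a b) (sym (ℤP.+-identityʳ _))))
  (begin
    scale a r ⊕ (p ⊗ (b ∷ r))                  ≈⟨ ⊕-cong ≋-refl (⊗-∷ p b r) ⟩
    scale a r ⊕ (scale b p ⊕ (+ 0 ∷ (p ⊗ r)))  ≈⟨ ⊕-assoc (scale a r) (scale b p) _ ⟨
    (scale a r ⊕ scale b p) ⊕ (+ 0 ∷ (p ⊗ r))  ≈⟨ ⊕-cong (⊕-comm (scale a r) (scale b p)) ≋-refl ⟩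
    (scale b p ⊕ scale a r) ⊕ (+ 0 ∷ (p ⊗ r))  ≈⟨ ⊕-assoc (scale b p) (scale a r) _ ⟩
    scale b p ⊕ (scale a r ⊕ (+ 0 ∷ (p ⊗ r)))  ∎)
  where open ≋-Reasoning

⊗-comm : ∀ p r → (p ⊗ r) ≋ (r ⊗ p)
⊗-comm []      r = ≋-sym (⊗-zeroʳ r)
⊗-comm (a ∷ p) r = ≋-trans (⊕-cong ≋-refl (∷-cong refl (⊗-comm p r))) (≋-sym (⊗-∷ r a p))

⊗-assoc : ∀ p r t → ((p ⊗ r) ⊗ t) ≋ (p ⊗ (r ⊗ t))
⊗-assoc []      r t = ≋-refl
⊗-assoc (a ∷ p) r t = ≋-trans
  (⊗-distribʳ (scale a r) (+ 0 ∷ (p ⊗ r)) t)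
  (⊕-cong (scale-⊗ a r t) (≋-trans (0∷-⊗ (p ⊗ r) t) (∷-cong refl (⊗-assoc p r t))))

⊗-identityˡ : ∀ p → (one ⊗ p) ≋ p
⊗-identityˡ p = ≋-trans (⊕-cong (scale-identity p) (0∷-zero ≋-refl)) (⊕-identityʳ p)

⊗-identityʳ : ∀ p → (p ⊗ one) ≋ p
⊗-identityʳ p = ≋-trans (⊗-comm p one) (⊗-identityˡ p)

neg : Poly → Poly
neg = scale (ℤ.- + 1)

⊕-inverseʳ : ∀ p → (p ⊕ neg p) ≋ []
⊕-inverseʳ p = mk λ i → begin
  coeff (p ⊕ neg p) i                ≡⟨ coeff-⊕ p (neg p) i ⟩
  coeff p i +ℤ coeff (neg p) i       ≡⟨ cong (coeff p i +ℤ_) (coeff-scale (ℤ.- + 1) p i) ⟩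
  coeff p i +ℤ ℤ.- + 1 *ℤ coeff p i  ≡⟨ cong (coeff p i +ℤ_) (ℤP.-1*i≡-i (coeff p i)) ⟩
  coeff p i +ℤ ℤ.- coeff p i         ≡⟨ ℤP.+-inverseʳ (coeff p i) ⟩
  + 0                                ∎
  where open ≡-Reasoning

⊕-inverseˡ : ∀ p → (neg p ⊕ p) ≋ []
⊕-inverseˡ p = ≋-trans (⊕-comm (neg p) p) (⊕-inverseʳ p)

poly-isCommutativeRing : IsCommutativeRing _≋_ _⊕_ _⊗_ neg [] one
poly-isCommutativeRing = record
  { isRing = record
    { +-isAbelianGroup = record
      { isGroup = record
        { isMonoid = record
          { isSemigroup = record
            { isMagma = record
              { isEquivalence = Setoid.isEquivalence ≋-setoid
              ; ∙-cong = ⊕-cong }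
            ; assoc = ⊕-assoc }
          ; identity = (λ _ → ≋-refl) , ⊕-identityʳ }
        ; inverse = ⊕-inverseˡ , ⊕-inverseʳ
        ; ⁻¹-cong = scale-cong (ℤ.- + 1) }
      ; comm = ⊕-comm }
    ; *-cong = ⊗-cong
    ; *-assoc = ⊗-assoc
    ; *-identity = ⊗-identityˡ , ⊗-identityʳ
    ; distrib = ⊗-distribˡ , λ r p p′ → ⊗-distribʳ p p′ r }
  ; *-comm = ⊗-comm }

poly-commutativeRing : CommutativeRing _ _
poly-commutativeRing = record { isCommutativeRing = poly-isCommutativeRing }

poly-ring : ACR.AlmostCommutativeRing _ _
poly-ring = ACR.fromCommutativeRing poly-commutativeRing isZero?
  where
  isZero? : ∀ p → Maybe ([] ≋ p)
  isZero? [] = just ≋-refl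
  isZero? (+ zero ∷ p) with isZero? p
  ... | just e  = just (≋-sym (0∷-zero (≋-sym e)))
  ... | nothing = nothing
  isZero? (_ ∷ _) = nothing

qpow : ℕ → Poly
qpow e = shift e one

cst : ℤ → Poly
cst c = c ∷ []

shift≈qpow⊗ : ∀ e p → shift e p ≋ (qpow e ⊗ p)
shift≈qpow⊗ zero    p = ≋-sym (⊗-identityˡ p)
shift≈qpow⊗ (suc e) p = ≋-trans (∷-cong refl (shift≈qpow⊗ e p)) (≋-sym (0∷-⊗ (qpow e) p))

scale≈cst⊗ : ∀ c p → scale c p ≋ (cst c ⊗ p)
scale≈cst⊗ c p = ≋-sym (≋-trans (⊕-cong ≋-refl (0∷-zero ≋-refl)) (⊕-identityʳ (scale c p)))

cst-neg : ∀ c → cst (ℤ.- c) ≋ neg (cst c)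
cst-neg c = ≡⇒≋ (cong (_∷ []) (sym (ℤP.-1*i≡-i c)))

shift-+ : ∀ a b p → shift (a + b) p ≡ shift a (shift b p)
shift-+ zero    b p = refl
shift-+ (suc a) b p = cong (+ 0 ∷_) (shift-+ a b p)

qpow-+ : ∀ a b → qpow (a + b) ≋ (qpow a ⊗ qpow b)
qpow-+ a b = ≋-trans (≡⇒≋ (shift-+ a b one)) (shift≈qpow⊗ a (qpow b))

shift-cong : ∀ e {p r} → p ≋ r → shift e p ≋ shift e r
shift-cong zero    e = e
shift-cong (suc n) e = ∷-cong refl (shift-cong n e)

shift-zero : ∀ e → shift e [] ≋ []
shift-zero zero    = ≋-refl
shift-zero (suc e) = 0∷-zero (shift-zero e)

scale-shift : ∀ c e p → scale c (shift e p) ≋ shift e (scale c p)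
scale-shift c zero    p = ≋-refl
scale-shift c (suc e) p = ∷-cong (ℤP.*-zeroʳ c) (scale-shift c e p)

shift-⊗ : ∀ e p r → shift e (p ⊗ r) ≋ (shift e p ⊗ r)
shift-⊗ e p r = begin
  shift e (p ⊗ r)   ≈⟨ shift≈qpow⊗ e (p ⊗ r) ⟩
  qpow e ⊗ (p ⊗ r)  ≈⟨ ⊗-assoc (qpow e) p r ⟨
  (qpow e ⊗ p) ⊗ r  ≈⟨ ⊗-congˡ r (shift≈qpow⊗ e p) ⟨
  shift e p ⊗ r     ∎
  where open ≋-Reasoning

^ᵖ-distrib-⊗ : ∀ p r n → ((p ⊗ r) ^ᵖ n) ≋ ((p ^ᵖ n) ⊗ (r ^ᵖ n))
^ᵖ-distrib-⊗ p r zero    = ≋-sym (⊗-identityˡ one)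
^ᵖ-distrib-⊗ p r (suc n) =
  ≋-trans (⊗-congʳ (p ⊗ r) (^ᵖ-distrib-⊗ p r n)) (interchange p r (p ^ᵖ n) (r ^ᵖ n))
  where
  interchange : ∀ a b c d → ((a ⊗ b) ⊗ (c ⊗ d)) ≋ ((a ⊗ c) ⊗ (b ⊗ d))
  interchange = solve-∀ poly-ring

∑ : ℕ → (ℕ → Poly) → Poly
∑ zero    f = []
∑ (suc n) f = f 0 ⊕ ∑ n (f ∘ suc)

∑-cong : ∀ n {f g} → (∀ i → i < n → f i ≋ g i) → ∑ n f ≋ ∑ n g
∑-cong zero    e = ≋-refl
∑-cong (suc n) e = ⊕-cong (e 0 (s≤s z≤n)) (∑-cong n λ i i<n → e (suc i) (s≤s i<n))

∑-zero : ∀ n {f} → (∀ i → i < n → f i ≋ []) → ∑ n f ≋ []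
∑-zero zero    e = ≋-refl
∑-zero (suc n) e = ⊕-cong (e 0 (s≤s z≤n)) (∑-zero n λ i i<n → e (suc i) (s≤s i<n))

∑-⊕ : ∀ n f g → ∑ n (λ i → f i ⊕ g i) ≋ (∑ n f ⊕ ∑ n g)
∑-⊕ zero    f g = ≋-refl
∑-⊕ (suc n) f g = ≋-trans (⊕-cong ≋-refl (∑-⊕ n (f ∘ suc) (g ∘ suc)))
                          (⊕-interchange (f 0) (g 0) (∑ n (f ∘ suc)) (∑ n (g ∘ suc)))

∑-⊗ˡ : ∀ n c f → ∑ n (λ i → c ⊗ f i) ≋ (c ⊗ ∑ n f)
∑-⊗ˡ zero    c f = ≋-sym (⊗-zeroʳ c)
∑-⊗ˡ (suc n) c f = ≋-trans (⊕-cong ≋-refl (∑-⊗ˡ n c (f ∘ suc))) (≋-sym (⊗-distribˡ c (f 0) _))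

∑-⊗ʳ : ∀ n c f → ∑ n (λ i → f i ⊗ c) ≋ (∑ n f ⊗ c)
∑-⊗ʳ n c f = ≋-trans (∑-cong n λ i _ → ⊗-comm (f i) c) (≋-trans (∑-⊗ˡ n c f) (⊗-comm c _))

∑-+ : ∀ m n f → ∑ (m + n) f ≋ (∑ m f ⊕ ∑ n (λ i → f (m + i)))
∑-+ zero    n f = ≋-refl
∑-+ (suc m) n f = ≋-trans (⊕-cong ≋-refl (∑-+ m n (f ∘ suc))) (≋-sym (⊕-assoc (f 0) _ _))

∑-suc : ∀ n f → ∑ (suc n) f ≋ (∑ n f ⊕ f n)
∑-suc n f = begin
  ∑ (suc n) f               ≡⟨ cong (λ m → ∑ m f) (ℕP.+-comm 1 n) ⟩
  ∑ (n + 1) f               ≈⟨ ∑-+ n 1 f ⟩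
  ∑ n f ⊕ (f (n + 0) ⊕ [])  ≈⟨ ⊕-congʳ (∑ n f) (⊕-identityʳ _) ⟩
  ∑ n f ⊕ f (n + 0)         ≡⟨ cong (λ i → ∑ n f ⊕ f i) (ℕP.+-identityʳ n) ⟩
  ∑ n f ⊕ f n               ∎
  where open ≋-Reasoning

∑-dropHead : ∀ m n f → (∀ i → i < m → f i ≋ []) → ∑ (m + n) f ≋ ∑ n (λ i → f (m + i))
∑-dropHead m n f e = ≋-trans (∑-+ m n f) (⊕-cong (∑-zero m e) ≋-refl)

∑-dropTail : ∀ m n f → m ≤ n → (∀ i → m ≤ i → i < n → f i ≋ []) → ∑ n f ≋ ∑ m f
∑-dropTail m n f m≤n vanish with ℕP.≤⇒≤″ m≤n
... | d , refl = ≋-trans (∑-+ m d f) (≋-trans (⊕-congʳ (∑ m f) tail≋[]) (⊕-identityʳ _))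
  where
  tail≋[] : ∑ d (λ i → f (m + i)) ≋ []
  tail≋[] = ∑-zero d λ i i<d → vanish (m + i) (ℕP.m≤m+n m i) (ℕP.+-monoʳ-< m i<d)

∑-truncate-⊓ : ∀ a′ b′ (f : ℕ → Poly) → (∀ i → a′ < i → f i ≋ []) → ∑ (suc b′) f ≋ ∑ (suc (a′ ⊓ b′)) f
∑-truncate-⊓ a′ b′ f vanish = ∑-dropTail (suc (a′ ⊓ b′)) (suc b′) f (s≤s (ℕP.m⊓n≤n a′ b′)) beyond
  where
  beyond : ∀ i → suc (a′ ⊓ b′) ≤ i → i < suc b′ → f i ≋ []
  beyond i ⊓<i i≤b′ with i ℕ.≤? a′
  ... | yes i≤a′ = ⊥-elim (ℕP.<-irrefl refl (ℕP.<-≤-trans ⊓<i (ℕP.⊓-glb i≤a′ (ℕP.≤-pred i≤b′))))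
  ... | no  i≰a′ = vanish i (ℕP.≰⇒> i≰a′)

∑-comm : ∀ m n (f : ℕ → ℕ → Poly) →
         ∑ m (λ i → ∑ n (f i)) ≋ ∑ n (λ j → ∑ m (λ i → f i j))
∑-comm zero    n f = ≋-sym (∑-zero n λ _ _ → ≋-refl)
∑-comm (suc m) n f = ≋-trans (⊕-cong ≋-refl (∑-comm m n (f ∘ suc)))
                             (≋-sym (∑-⊕ n (f 0) λ j → ∑ m (λ i → f (suc i) j)))

∑-reverse : ∀ n f → ∑ (suc n) f ≋ ∑ (suc n) (λ i → f (n ∸ i))
∑-reverse zero    f = ≋-refl
∑-reverse (suc n) f = begin
  ∑ (suc (suc n)) f                        ≈⟨ ∑-suc (suc n) f ⟩
  ∑ (suc n) f ⊕ f (suc n)                  ≈⟨ ⊕-cong (∑-reverse n f) ≋-refl ⟩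
  ∑ (suc n) (λ i → f (n ∸ i)) ⊕ f (suc n)  ≈⟨ ⊕-comm _ (f (suc n)) ⟩
  ∑ (suc (suc n)) (λ i → f (suc n ∸ i))    ∎
  where open ≋-Reasoning

polySum≡∑ : ∀ L f → polySum L f ≡ ∑ (suc (2 * L)) (λ i → f (+ i ℤ.- + L))
polySum≡∑ L f = foldr-applyUpTo (suc (2 * L)) id
  where
  foldr-applyUpTo : ∀ n (g : ℕ → ℕ) →
    foldr (λ i acc → f (+ i ℤ.- + L) ⊕ acc) [] (applyUpTo g n) ≡ ∑ n (λ i → f (+ g i ℤ.- + L))
  foldr-applyUpTo zero    g = refl
  foldr-applyUpTo (suc n) g = cong (f (+ g 0 ℤ.- + L) ⊕_) (foldr-applyUpTo n (g ∘ suc))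

polySum-cong : ∀ L {f g} → (∀ k → f k ≋ g k) → polySum L f ≋ polySum L g
polySum-cong L {f} {g} e = begin
  polySum L f                              ≡⟨ polySum≡∑ L f ⟩
  ∑ (suc (2 * L)) (λ i → f (+ i ℤ.- + L))  ≈⟨ ∑-cong (suc (2 * L)) (λ i _ → e (+ i ℤ.- + L)) ⟩
  ∑ (suc (2 * L)) (λ i → g (+ i ℤ.- + L))  ≡⟨ polySum≡∑ L g ⟨
  polySum L g                              ∎
  where open ≋-Reasoning

polySum-⊗ˡ : ∀ L c f → polySum L (λ k → c ⊗ f k) ≋ (c ⊗ polySum L f)
polySum-⊗ˡ L c f = begin
  polySum L (λ k → c ⊗ f k)                    ≡⟨ polySum≡∑ L (λ k → c ⊗ f k) ⟩
  ∑ (suc (2 * L)) (λ i → c ⊗ f (+ i ℤ.- + L))  ≈⟨ ∑-⊗ˡ (suc (2 * L)) c (λ i → f (+ i ℤ.- + L)) ⟩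
  c ⊗ ∑ (suc (2 * L)) (λ i → f (+ i ℤ.- + L))  ≡⟨ cong (c ⊗_) (polySum≡∑ L f) ⟨
  c ⊗ polySum L f                              ∎
  where open ≋-Reasoning

polySum-∑-comm : ∀ L n (f : ℤ → ℕ → Poly) →
                 polySum L (λ k → ∑ n (f k)) ≋ ∑ n (λ s → polySum L (λ k → f k s))
polySum-∑-comm L n f = begin
  polySum L (λ k → ∑ n (f k))                            ≡⟨ polySum≡∑ L (λ k → ∑ n (f k)) ⟩
  ∑ (suc (2 * L)) (λ i → ∑ n (f (+ i ℤ.- + L)))          ≈⟨ ∑-comm (suc (2 * L)) n (λ i → f (+ i ℤ.- + L)) ⟩
  ∑ n (λ s → ∑ (suc (2 * L)) (λ i → f (+ i ℤ.- + L) s))  ≈⟨ ∑-cong n (λ s _ → ≡⇒≋ (sym (polySum≡∑ L (λ k → f k s)))) ⟩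
  ∑ n (λ s → polySum L (λ k → f k s))                    ∎
  where open ≋-Reasoning

polySum-suc : ∀ L f → polySum (suc L) f ≋ ((f (ℤ.- + suc L) ⊕ polySum L f) ⊕ f (+ suc L))
polySum-suc L f = begin
  polySum (suc L) f                                  ≡⟨ polySum≡∑ (suc L) f ⟩
  ∑ (suc (2 * suc L)) g                              ≡⟨ cong (λ n → ∑ (suc n) g) (ℕP.*-suc 2 L) ⟩
  g 0 ⊕ ∑ (suc (suc (2 * L))) (g ∘ suc)              ≈⟨ ⊕-congʳ (g 0) (∑-suc (suc (2 * L)) (g ∘ suc)) ⟩
  g 0 ⊕ (∑ (suc (2 * L)) (g ∘ suc) ⊕ g (2 + 2 * L))  ≈⟨ ⊕-assoc (g 0) _ _ ⟨
  (g 0 ⊕ ∑ (suc (2 * L)) (g ∘ suc)) ⊕ g (2 + 2 * L)  ≈⟨ ⊕-cong (⊕-cong first middle) last ⟩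
  (f (ℤ.- + suc L) ⊕ polySum L f) ⊕ f (+ suc L)      ∎
  where
  open ≋-Reasoning
  g : ℕ → Poly
  g i = f (+ i ℤ.- + suc L)
  first : g 0 ≋ f (ℤ.- + suc L)
  first = ≡⇒≋ (cong f (ℤP.+-identityˡ _))
  middle : ∑ (suc (2 * L)) (g ∘ suc) ≋ polySum L f
  middle = ≋-trans (∑-cong (suc (2 * L)) λ i _ → ≡⇒≋ (cong f (shiftIndex (+ i) (+ L))))
                   (≡⇒≋ (sym (polySum≡∑ L f)))
    where
    shiftIndex : ∀ i L → (+ 1 +ℤ i) ℤ.- (+ 1 +ℤ L) ≡ i ℤ.- L
    shiftIndex = ℤ-Solver.solve-∀
  last : g (2 + 2 * L) ≋ f (+ suc L)
  last = ≡⇒≋ (cong f (trans (cong (λ n → + n ℤ.- + suc L) (twoL L)) (cancel (+ suc L))))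
    where
    cancel : ∀ a → (a +ℤ a) ℤ.- a ≡ a
    cancel = ℤ-Solver.solve-∀
    twoL : ∀ L → 2 + 2 * L ≡ suc L + suc L
    twoL = ℕ-Solver.solve-∀

polySum-shrink : ∀ L d f → (∀ κ → L < κ → f (+ κ) ≋ []) → (∀ κ → L < κ → f (ℤ.- + κ) ≋ []) →
                 polySum (d + L) f ≋ polySum L f
polySum-shrink L zero    f vanish⁺ vanish⁻ = ≋-refl
polySum-shrink L (suc d) f vanish⁺ vanish⁻ = begin
  polySum (suc d + L) f
    ≈⟨ polySum-suc (d + L) f ⟩
  (f (ℤ.- + suc (d + L)) ⊕ polySum (d + L) f) ⊕ f (+ suc (d + L))
    ≈⟨ ⊕-cong (⊕-cong (vanish⁻ _ L<) (polySum-shrink L d f vanish⁺ vanish⁻)) (vanish⁺ _ L<) ⟩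
  polySum L f ⊕ []
    ≈⟨ ⊕-identityʳ _ ⟩
  polySum L f ∎
  where
  open ≋-Reasoning
  L< : L < suc (d + L)
  L< = s≤s (ℕP.m≤n+m L d)

-- q-binomial coefficients and q-factorials

k>n⇒qbin≋[] : ∀ n k → n < k → qbin n k ≋ []
k>n⇒qbin≋[] zero    (suc k) _         = ≋-refl
k>n⇒qbin≋[] (suc n) (suc k) (s≤s n<k) = ⊕-cong (k>n⇒qbin≋[] n k n<k)
  (≋-trans (shift-cong (suc k) (k>n⇒qbin≋[] n (suc k) (ℕP.m≤n⇒m≤1+n n<k))) (shift-zero (suc k)))

qbin-n-n : ∀ n → qbin n n ≋ one
qbin-n-n zero    = ≋-refl
qbin-n-n (suc n) = ≋-trans
  (⊕-cong (qbin-n-n n) (≋-trans (shift-cong (suc n) (k>n⇒qbin≋[] n (suc n) (ℕP.n<1+n n))) (shift-zero (suc n))))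
  (⊕-identityʳ one)

qbin⁺ : ℕ → ℕ → Poly
qbin⁺ x y = qbin (x + y) x

qbin≡qbin⁺ : ∀ {n k} x y → n ≡ x + y → k ≡ x → qbin n k ≋ qbin⁺ x y
qbin≡qbin⁺ x y refl refl = ≋-refl

∸-offset : ∀ κ t β → (κ + (t + β)) ∸ (κ + t) ≡ β
∸-offset κ t β = trans (ℕP.[m+n]∸[m+o]≡n∸o κ (t + β) t) (ℕP.m+n∸m≡n t β)

1-q^_ : ℕ → Poly
1-q^ e = one ⊕ neg (qpow e)

qfac : ℕ → Poly
qfac zero    = one
qfac (suc n) = qfac n ⊗ 1-q^ suc n

ConstantTermOne : Poly → Set
ConstantTermOne p = coeff p 0 ≡ + 1

coeff₀-⊗ : ∀ p r → coeff (p ⊗ r) 0 ≡ coeff p 0 *ℤ coeff r 0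
coeff₀-⊗ []      r = refl
coeff₀-⊗ (a ∷ p) r = trans (coeff-⊕ (scale a r) (+ 0 ∷ (p ⊗ r)) 0)
                           (trans (ℤP.+-identityʳ _) (coeff-scale a r 0))

⊗-constantTermOne : ∀ p r → ConstantTermOne p → ConstantTermOne r → ConstantTermOne (p ⊗ r)
⊗-constantTermOne p r u v = trans (coeff₀-⊗ p r) (cong₂ _*ℤ_ u v)

qfac-constantTermOne : ∀ n → ConstantTermOne (qfac n)
qfac-constantTermOne zero    = refl
qfac-constantTermOne (suc n) = ⊗-constantTermOne (qfac n) (1-q^ suc n) (qfac-constantTermOne n) refl

⊗-cancelʳ-[] : ∀ p r → ConstantTermOne r → (p ⊗ r) ≋ [] → p ≋ []
⊗-cancelʳ-[] []      r u e = ≋-refl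
⊗-cancelʳ-[] (a ∷ p) r u e = ≋-trans (∷-cong a≡0 (≋-refl {p})) (0∷-zero (⊗-cancelʳ-[] p r u p⊗r≋[]))
  where
  a≡0 : a ≡ + 0
  a≡0 = begin
    a                      ≡⟨ ℤP.*-identityʳ a ⟨
    a *ℤ + 1               ≡⟨ cong (a *ℤ_) u ⟨
    a *ℤ coeff r 0         ≡⟨ coeff₀-⊗ (a ∷ p) r ⟨
    coeff ((a ∷ p) ⊗ r) 0  ≡⟨ coeff-≡ e 0 ⟩
    + 0                    ∎
    where open ≡-Reasoning
  p⊗r≋[] : (p ⊗ r) ≋ []
  p⊗r≋[] = ∷-zero-tail (≋-trans (≋-sym (0∷-⊗ p r)) (≋-trans (⊗-congˡ r (∷-cong (sym a≡0) (≋-refl {p}))) e))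

⊗-cancelʳ : ∀ p p′ r → ConstantTermOne r → (p ⊗ r) ≋ (p′ ⊗ r) → p ≋ p′
⊗-cancelʳ p p′ r u e = begin
  p                        ≈⟨ split p p′ ⟩
  (p ⊕ neg p′) ⊕ p′  ≈⟨ ⊕-congˡ p′ (⊗-cancelʳ-[] (p ⊕ neg p′) r u difference≋[]) ⟩
  [] ⊕ p′            ∎
  where
  open ≋-Reasoning
  split : ∀ p p′ → p ≋ ((p ⊕ neg p′) ⊕ p′)
  split = solve-∀ poly-ring
  distrib : ∀ p p′ r → ((p ⊕ neg p′) ⊗ r) ≋ ((p ⊗ r) ⊕ neg (p′ ⊗ r))
  distrib = solve-∀ poly-ring
  difference≋[] : ((p ⊕ neg p′) ⊗ r) ≋ []
  difference≋[] = ≋-trans (distrib p p′ r) (≋-trans (⊕-congˡ (neg (p′ ⊗ r)) e) (⊕-inverseʳ (p′ ⊗ r)))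

qbin⁺-qfac : ∀ x y → (qbin⁺ x y ⊗ (qfac x ⊗ qfac y)) ≋ qfac (x + y)
qbin⁺-qfac zero    y = ≋-trans (⊗-identityˡ _) (⊗-identityˡ _)
qbin⁺-qfac (suc x) zero rewrite ℕP.+-identityʳ x =
  ≋-trans (⊗-cong (qbin-n-n (suc x)) (⊗-identityʳ _)) (⊗-identityˡ _)
qbin⁺-qfac (suc x) (suc y) = begin
  qbin⁺ (suc x) (suc y) ⊗ (qfac (suc x) ⊗ qfac (suc y))
    ≈⟨ ⊗-congˡ (qfac (suc x) ⊗ qfac (suc y)) pascal ⟩
  (qbin⁺ x (suc y) ⊕ (Qx ⊗ qbin⁺ (suc x) y)) ⊗ ((qfac x ⊗ (one ⊕ neg Qx)) ⊗ (qfac y ⊗ (one ⊕ neg Qy)))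
    ≈⟨ regroup (qbin⁺ x (suc y)) (qbin⁺ (suc x) y) (qfac x) (qfac y) Qx Qy ⟩
  ((qbin⁺ x (suc y) ⊗ (qfac x ⊗ qfac (suc y))) ⊗ (one ⊕ neg Qx))
    ⊕ (Qx ⊗ ((qbin⁺ (suc x) y ⊗ (qfac (suc x) ⊗ qfac y)) ⊗ (one ⊕ neg Qy)))
    ≈⟨ ⊕-cong (⊗-congˡ (one ⊕ neg Qx) (qbin⁺-qfac x (suc y)))
              (⊗-congʳ Qx (⊗-congˡ (one ⊕ neg Qy) (≋-trans (qbin⁺-qfac (suc x) y) (≡⇒≋ (cong qfac (sym (ℕP.+-suc x y))))))) ⟩
  (F ⊗ (one ⊕ neg Qx)) ⊕ (Qx ⊗ (F ⊗ (one ⊕ neg Qy)))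
    ≈⟨ telescope F Qx Qy ⟩
  F ⊗ (one ⊕ neg (Qx ⊗ Qy))
    ≈⟨ ⊗-congʳ F (⊕-congʳ one (scale-cong (ℤ.- + 1) (qpow-+ (suc x) (suc y)))) ⟨
  qfac (suc x + suc y) ∎
  where
  open ≋-Reasoning
  Qx = qpow (suc x)
  Qy = qpow (suc y)
  F = qfac (x + suc y)
  pascal : qbin⁺ (suc x) (suc y) ≋ (qbin⁺ x (suc y) ⊕ (Qx ⊗ qbin⁺ (suc x) y))
  pascal = ⊕-congʳ (qbin⁺ x (suc y))
    (≋-trans (shift≈qpow⊗ (suc x) _) (⊗-congʳ Qx (≡⇒≋ (cong (λ n → qbin n (suc x)) (ℕP.+-suc x y)))))
  regroup : ∀ B₁ B₂ fx fy Qx Qy →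
    ((B₁ ⊕ (Qx ⊗ B₂)) ⊗ ((fx ⊗ (one ⊕ neg Qx)) ⊗ (fy ⊗ (one ⊕ neg Qy))))
      ≋ (((B₁ ⊗ (fx ⊗ (fy ⊗ (one ⊕ neg Qy)))) ⊗ (one ⊕ neg Qx))
         ⊕ (Qx ⊗ ((B₂ ⊗ ((fx ⊗ (one ⊕ neg Qx)) ⊗ fy)) ⊗ (one ⊕ neg Qy))))
  regroup = solve-∀ poly-ring
  telescope : ∀ F Qx Qy → ((F ⊗ (one ⊕ neg Qx)) ⊕ (Qx ⊗ (F ⊗ (one ⊕ neg Qy)))) ≋ (F ⊗ (one ⊕ neg (Qx ⊗ Qy)))
  telescope = solve-∀ poly-ring

qfac₂-constantTermOne : ∀ x y → ConstantTermOne (qfac x ⊗ qfac y)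
qfac₂-constantTermOne x y = ⊗-constantTermOne (qfac x) (qfac y) (qfac-constantTermOne x) (qfac-constantTermOne y)

qbin⁺-comm : ∀ x y → qbin⁺ x y ≋ qbin⁺ y x
qbin⁺-comm x y = ⊗-cancelʳ _ _ (qfac x ⊗ qfac y) (qfac₂-constantTermOne x y) (begin
  qbin⁺ x y ⊗ (qfac x ⊗ qfac y)  ≈⟨ qbin⁺-qfac x y ⟩
  qfac (x + y)                   ≡⟨ cong qfac (ℕP.+-comm x y) ⟩
  qfac (y + x)                   ≈⟨ qbin⁺-qfac y x ⟨
  qbin⁺ y x ⊗ (qfac y ⊗ qfac x)  ≈⟨ ⊗-congʳ (qbin⁺ y x) (⊗-comm (qfac y) (qfac x)) ⟩
  qbin⁺ y x ⊗ (qfac x ⊗ qfac y)  ∎)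
  where open ≋-Reasoning

qbin⁺-trinomial : ∀ x y z → (qbin⁺ x (y + z) ⊗ qbin⁺ y z) ≋ (qbin⁺ (x + y) z ⊗ qbin⁺ x y)
qbin⁺-trinomial x y z = ⊗-cancelʳ _ _ (qfac x ⊗ (qfac y ⊗ qfac z)) unit (begin
  (qbin⁺ x (y + z) ⊗ qbin⁺ y z) ⊗ (fx ⊗ (fy ⊗ fz))  ≈⟨ regroupˡ (qbin⁺ x (y + z)) (qbin⁺ y z) fx fy fz ⟩
  qbin⁺ x (y + z) ⊗ (fx ⊗ (qbin⁺ y z ⊗ (fy ⊗ fz)))  ≈⟨ ⊗-congʳ (qbin⁺ x (y + z)) (⊗-congʳ fx (qbin⁺-qfac y z)) ⟩
  qbin⁺ x (y + z) ⊗ (fx ⊗ qfac (y + z))             ≈⟨ qbin⁺-qfac x (y + z) ⟩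
  qfac (x + (y + z))                                ≡⟨ cong qfac (ℕP.+-assoc x y z) ⟨
  qfac (x + y + z)                                  ≈⟨ qbin⁺-qfac (x + y) z ⟨
  qbin⁺ (x + y) z ⊗ (qfac (x + y) ⊗ fz)             ≈⟨ ⊗-congʳ (qbin⁺ (x + y) z) (⊗-congˡ fz (qbin⁺-qfac x y)) ⟨
  qbin⁺ (x + y) z ⊗ ((qbin⁺ x y ⊗ (fx ⊗ fy)) ⊗ fz)  ≈⟨ regroupʳ (qbin⁺ (x + y) z) (qbin⁺ x y) fx fy fz ⟩
  (qbin⁺ (x + y) z ⊗ qbin⁺ x y) ⊗ (fx ⊗ (fy ⊗ fz))  ∎)
  where
  open ≋-Reasoning
  fx = qfac x
  fy = qfac y
  fz = qfac z
  unit : ConstantTermOne (fx ⊗ (fy ⊗ fz))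
  unit = ⊗-constantTermOne fx (fy ⊗ fz) (qfac-constantTermOne x) (qfac₂-constantTermOne y z)
  regroupˡ : ∀ P Q a b c → ((P ⊗ Q) ⊗ (a ⊗ (b ⊗ c))) ≋ (P ⊗ (a ⊗ (Q ⊗ (b ⊗ c))))
  regroupˡ = solve-∀ poly-ring
  regroupʳ : ∀ P Q a b c → (P ⊗ ((Q ⊗ (a ⊗ b)) ⊗ c)) ≋ ((P ⊗ Q) ⊗ (a ⊗ (b ⊗ c)))
  regroupʳ = solve-∀ poly-ring

qbin⁺-quadrinomial : ∀ α β γ δ →
  (qbin⁺ α (β + (γ + δ)) ⊗ (qbin⁺ β (γ + δ) ⊗ qbin⁺ γ δ)) ≋ (qbin⁺ (β + γ) (α + δ) ⊗ (qbin⁺ β γ ⊗ qbin⁺ α δ))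
qbin⁺-quadrinomial α β γ δ = ⊗-cancelʳ _ _ R unit (begin
  (qbin⁺ α (β + (γ + δ)) ⊗ (qbin⁺ β (γ + δ) ⊗ qbin⁺ γ δ)) ⊗ R
    ≈⟨ regroupˡ (qbin⁺ α (β + (γ + δ))) (qbin⁺ β (γ + δ)) (qbin⁺ γ δ) fα fβ fγ fδ ⟩
  qbin⁺ α (β + (γ + δ)) ⊗ (fα ⊗ (qbin⁺ β (γ + δ) ⊗ (fβ ⊗ (qbin⁺ γ δ ⊗ (fγ ⊗ fδ)))))
    ≈⟨ ⊗-congʳ (qbin⁺ α _) (⊗-congʳ fα (⊗-congʳ (qbin⁺ β _) (⊗-congʳ fβ (qbin⁺-qfac γ δ)))) ⟩
  qbin⁺ α (β + (γ + δ)) ⊗ (fα ⊗ (qbin⁺ β (γ + δ) ⊗ (fβ ⊗ qfac (γ + δ))))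
    ≈⟨ ⊗-congʳ (qbin⁺ α _) (⊗-congʳ fα (qbin⁺-qfac β (γ + δ))) ⟩
  qbin⁺ α (β + (γ + δ)) ⊗ (fα ⊗ qfac (β + (γ + δ)))
    ≈⟨ qbin⁺-qfac α (β + (γ + δ)) ⟩
  qfac (α + (β + (γ + δ)))
    ≡⟨ cong qfac (sum-rearrangement α β γ δ) ⟩
  qfac ((β + γ) + (α + δ))
    ≈⟨ qbin⁺-qfac (β + γ) (α + δ) ⟨
  qbin⁺ (β + γ) (α + δ) ⊗ (qfac (β + γ) ⊗ qfac (α + δ))
    ≈⟨ ⊗-congʳ (qbin⁺ (β + γ) _) (⊗-cong (qbin⁺-qfac β γ) (qbin⁺-qfac α δ)) ⟨
  qbin⁺ (β + γ) (α + δ) ⊗ ((qbin⁺ β γ ⊗ (fβ ⊗ fγ)) ⊗ (qbin⁺ α δ ⊗ (fα ⊗ fδ)))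
    ≈⟨ regroupʳ (qbin⁺ (β + γ) (α + δ)) (qbin⁺ β γ) (qbin⁺ α δ) fα fβ fγ fδ ⟩
  (qbin⁺ (β + γ) (α + δ) ⊗ (qbin⁺ β γ ⊗ qbin⁺ α δ)) ⊗ R ∎)
  where
  open ≋-Reasoning
  fα = qfac α
  fβ = qfac β
  fγ = qfac γ
  fδ = qfac δ
  R = (fα ⊗ fβ) ⊗ (fγ ⊗ fδ)
  unit : ConstantTermOne R
  unit = ⊗-constantTermOne (fα ⊗ fβ) (fγ ⊗ fδ) (qfac₂-constantTermOne α β) (qfac₂-constantTermOne γ δ)
  regroupˡ : ∀ P Q S a b c d →
    ((P ⊗ (Q ⊗ S)) ⊗ ((a ⊗ b) ⊗ (c ⊗ d))) ≋ (P ⊗ (a ⊗ (Q ⊗ (b ⊗ (S ⊗ (c ⊗ d))))))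
  regroupˡ = solve-∀ poly-ring
  regroupʳ : ∀ P Q S a b c d →
    (P ⊗ ((Q ⊗ (b ⊗ c)) ⊗ (S ⊗ (a ⊗ d)))) ≋ ((P ⊗ (Q ⊗ S)) ⊗ ((a ⊗ b) ⊗ (c ⊗ d)))
  regroupʳ = solve-∀ poly-ring
  sum-rearrangement : ∀ α β γ δ → α + (β + (γ + δ)) ≡ (β + γ) + (α + δ)
  sum-rearrangement = ℕ-Solver.solve-∀

-- The q-Vandermonde identity

vandermondeTerm : ℕ → ℕ → ℕ → ℕ → Poly
vandermondeTerm X Y Z t = qpow ((X ∸ t) * (Z ∸ t)) ⊗ (qbin X t ⊗ qbin Y (Z ∸ t))

vandermondeTerm-head : ∀ X Y Z → vandermondeTerm (suc X) Y (suc Z) 0 ≋ (qpow (suc Z) ⊗ vandermondeTerm X Y (suc Z) 0)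
vandermondeTerm-head X Y Z = ≋-trans (⊗-congˡ (one ⊗ qbin Y (suc Z)) (qpow-+ (suc Z) (X * suc Z)))
                                     (⊗-assoc (qpow (suc Z)) (qpow (X * suc Z)) (one ⊗ qbin Y (suc Z)))

vandermondeExponent : ∀ X Z t → t < X → t ≤ Z → (X ∸ t) * (Z ∸ t) + suc t ≡ suc Z + (X ∸ suc t) * (Z ∸ t)
vandermondeExponent X Z t t<X t≤Z with ℕP.≤⇒≤″ t<X | ℕP.≤⇒≤″ t≤Z
... | d , refl | e , refl
  rewrite ℕP.m+n∸m≡n (suc t) d | ℕP.m+n∸m≡n t e
        | ℕP.+-∸-assoc 1 (ℕP.m≤m+n t d) | ℕP.m+n∸m≡n t d = identity d e t
  where
  identity : ∀ d e t → suc d * e + suc t ≡ suc (t + e) + d * e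
  identity = ℕ-Solver.solve-∀

vandermondeTerm-pascal : ∀ X Y Z t → t ≤ Z →
  (vandermondeTerm X Y Z t ⊕ (qpow (suc Z) ⊗ vandermondeTerm X Y (suc Z) (suc t)))
    ≋ vandermondeTerm (suc X) Y (suc Z) (suc t)
vandermondeTerm-pascal X Y Z t t≤Z = begin
  vandermondeTerm X Y Z t ⊕ (qpow (suc Z) ⊗ vandermondeTerm X Y (suc Z) (suc t))
    ≈⟨ ⊕-congʳ (vandermondeTerm X Y Z t) (≋-sym shifted) ⟩
  (Q ⊗ (qbin X t ⊗ B)) ⊕ (Q ⊗ (qpow (suc t) ⊗ (qbin X (suc t) ⊗ B)))
    ≈⟨ distrib Q (qbin X t) (qpow (suc t)) (qbin X (suc t)) B ⟩
  Q ⊗ ((qbin X t ⊕ (qpow (suc t) ⊗ qbin X (suc t))) ⊗ B)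
    ≈⟨ ⊗-congʳ Q (⊗-congˡ B (⊕-congʳ (qbin X t) (shift≈qpow⊗ (suc t) (qbin X (suc t))))) ⟨
  vandermondeTerm (suc X) Y (suc Z) (suc t) ∎
  where
  open ≋-Reasoning
  Q = qpow ((X ∸ t) * (Z ∸ t))
  B = qbin Y (Z ∸ t)
  distrib : ∀ Q a e b B → ((Q ⊗ (a ⊗ B)) ⊕ (Q ⊗ (e ⊗ (b ⊗ B)))) ≋ (Q ⊗ ((a ⊕ (e ⊗ b)) ⊗ B))
  distrib = solve-∀ poly-ring
  reassoc : ∀ Q e P → (Q ⊗ (e ⊗ P)) ≋ ((Q ⊗ e) ⊗ P)
  reassoc = solve-∀ poly-ring
  shifted : (Q ⊗ (qpow (suc t) ⊗ (qbin X (suc t) ⊗ B))) ≋ (qpow (suc Z) ⊗ vandermondeTerm X Y (suc Z) (suc t))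
  shifted with t ℕ.<? X
  ... | yes t<X = begin
    Q ⊗ (qpow (suc t) ⊗ (qbin X (suc t) ⊗ B))
      ≈⟨ reassoc Q (qpow (suc t)) (qbin X (suc t) ⊗ B) ⟩
    (Q ⊗ qpow (suc t)) ⊗ (qbin X (suc t) ⊗ B)
      ≈⟨ ⊗-congˡ (qbin X (suc t) ⊗ B) (qpow-+ ((X ∸ t) * (Z ∸ t)) (suc t)) ⟨
    qpow ((X ∸ t) * (Z ∸ t) + suc t) ⊗ (qbin X (suc t) ⊗ B)
      ≡⟨ cong (λ e → qpow e ⊗ (qbin X (suc t) ⊗ B)) (vandermondeExponent X Z t t<X t≤Z) ⟩
    qpow (suc Z + (X ∸ suc t) * (Z ∸ t)) ⊗ (qbin X (suc t) ⊗ B)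
      ≈⟨ ⊗-congˡ (qbin X (suc t) ⊗ B) (qpow-+ (suc Z) ((X ∸ suc t) * (Z ∸ t))) ⟩
    (qpow (suc Z) ⊗ qpow ((X ∸ suc t) * (Z ∸ t))) ⊗ (qbin X (suc t) ⊗ B)
      ≈⟨ ⊗-assoc (qpow (suc Z)) (qpow ((X ∸ suc t) * (Z ∸ t))) (qbin X (suc t) ⊗ B) ⟩
    qpow (suc Z) ⊗ vandermondeTerm X Y (suc Z) (suc t) ∎
  ... | no t≮X = ≋-trans (⊗-vanishʳ Q (⊗-vanishʳ (qpow (suc t)) (⊗-vanishˡ B X<t+1)))
                         (≋-sym (⊗-vanishʳ (qpow (suc Z)) (⊗-vanishʳ (qpow ((X ∸ suc t) * (Z ∸ t))) (⊗-vanishˡ B X<t+1))))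
    where
    X<t+1 : qbin X (suc t) ≋ []
    X<t+1 = k>n⇒qbin≋[] X (suc t) (s≤s (ℕP.≮⇒≥ t≮X))

qVandermonde : ∀ X Y Z → qbin (X + Y) Z ≋ ∑ (suc Z) (vandermondeTerm X Y Z)
qVandermonde zero    Y Z       = ≋-sym (≋-trans
  (⊕-cong (≋-trans (⊗-identityˡ _) (⊗-identityˡ _)) (∑-zero Z λ i _ → ⊗-zeroʳ (qpow ((0 ∸ suc i) * (Z ∸ suc i)))))
  (⊕-identityʳ (qbin Y Z)))
qVandermonde (suc X) Y zero    = ≋-sym (≋-trans (⊕-identityʳ _)
  (≋-trans (⊗-cong (≡⇒≋ (cong qpow (ℕP.*-zeroʳ (suc X)))) (⊗-identityˡ one)) (⊗-identityˡ one)))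
qVandermonde (suc X) Y (suc Z) = begin
  qbin (X + Y) Z ⊕ shift (suc Z) (qbin (X + Y) (suc Z))
    ≈⟨ ⊕-cong (qVandermonde X Y Z) (≋-trans (shift≈qpow⊗ (suc Z) _) (⊗-congʳ Q (qVandermonde X Y (suc Z)))) ⟩
  ∑ (suc Z) (v Z) ⊕ (Q ⊗ (v (suc Z) 0 ⊕ ∑ (suc Z) (v (suc Z) ∘ suc)))
    ≈⟨ ⊕-congʳ (∑ (suc Z) (v Z)) (⊗-distribˡ Q (v (suc Z) 0) _) ⟩
  ∑ (suc Z) (v Z) ⊕ ((Q ⊗ v (suc Z) 0) ⊕ (Q ⊗ ∑ (suc Z) (v (suc Z) ∘ suc)))
    ≈⟨ swap (∑ (suc Z) (v Z)) (Q ⊗ v (suc Z) 0) _ ⟩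
  (Q ⊗ v (suc Z) 0) ⊕ (∑ (suc Z) (v Z) ⊕ (Q ⊗ ∑ (suc Z) (v (suc Z) ∘ suc)))
    ≈⟨ ⊕-congʳ (Q ⊗ v (suc Z) 0) (⊕-congʳ (∑ (suc Z) (v Z)) (∑-⊗ˡ (suc Z) Q (v (suc Z) ∘ suc))) ⟨
  (Q ⊗ v (suc Z) 0) ⊕ (∑ (suc Z) (v Z) ⊕ ∑ (suc Z) (λ t → Q ⊗ v (suc Z) (suc t)))
    ≈⟨ ⊕-cong (≋-sym (vandermondeTerm-head X Y Z)) (≋-sym (∑-⊕ (suc Z) (v Z) (λ t → Q ⊗ v (suc Z) (suc t)))) ⟩
  vandermondeTerm (suc X) Y (suc Z) 0 ⊕ ∑ (suc Z) (λ t → v Z t ⊕ (Q ⊗ v (suc Z) (suc t)))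
    ≈⟨ ⊕-congʳ (vandermondeTerm (suc X) Y (suc Z) 0) (∑-cong (suc Z) λ t t<1+Z → vandermondeTerm-pascal X Y Z t (ℕP.≤-pred t<1+Z)) ⟩
  ∑ (suc (suc Z)) (vandermondeTerm (suc X) Y (suc Z)) ∎
  where
  open ≋-Reasoning
  Q = qpow (suc Z)
  v = vandermondeTerm X Y
  swap : ∀ a b c → (a ⊕ (b ⊕ c)) ≋ (b ⊕ (a ⊕ c))
  swap = solve-∀ poly-ring

reversedVandermondeExponent : ∀ Y Z t → t ≤ Z → Z ≤ Y → (Y ∸ (Z ∸ t)) * (Z ∸ (Z ∸ t)) ≡ t * ((Y ∸ Z) + t)
reversedVandermondeExponent Y Z t t≤Z Z≤Y with ℕP.≤⇒≤″ t≤Z | ℕP.≤⇒≤″ Z≤Y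
... | z , refl | y , refl = begin
  (t + z + y ∸ (t + z ∸ t)) * (t + z ∸ (t + z ∸ t))  ≡⟨ cong (λ w → (t + z + y ∸ w) * (t + z ∸ w)) (ℕP.m+n∸m≡n t z) ⟩
  (t + z + y ∸ z) * (t + z ∸ z)                      ≡⟨ cong₂ _*_ (cong (_∸ z) (rearrange t z y)) (ℕP.m+n∸n≡m t z) ⟩
  (t + y + z ∸ z) * t                                ≡⟨ cong (_* t) (ℕP.m+n∸n≡m (t + y) z) ⟩
  (t + y) * t                                        ≡⟨ ℕP.*-comm (t + y) t ⟩
  t * (t + y)                                        ≡⟨ cong (t *_) (ℕP.+-comm t y) ⟩
  t * (y + t)                                        ≡⟨ cong (λ w → t * (w + t)) (ℕP.m+n∸m≡n (t + z) y) ⟨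
  t * ((t + z + y ∸ (t + z)) + t)                    ∎
  where
  open ≡-Reasoning
  rearrange : ∀ t z y → t + z + y ≡ t + y + z
  rearrange = ℕ-Solver.solve-∀

reversedVandermondeTerm : ℕ → ℕ → ℕ → ℕ → Poly
reversedVandermondeTerm X Y Z t = qpow (t * ((Y ∸ Z) + t)) ⊗ (qbin X t ⊗ qbin Y (Z ∸ t))

qVandermonde-reversed : ∀ X Y Z → Z ≤ Y → qbin (X + Y) Z ≋ ∑ (suc Z) (reversedVandermondeTerm X Y Z)
qVandermonde-reversed X Y Z Z≤Y = begin
  qbin (X + Y) Z                                   ≡⟨ cong (λ n → qbin n Z) (ℕP.+-comm X Y) ⟩
  qbin (Y + X) Z                                   ≈⟨ qVandermonde Y X Z ⟩
  ∑ (suc Z) (vandermondeTerm Y X Z)                ≈⟨ ∑-reverse Z (vandermondeTerm Y X Z) ⟩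
  ∑ (suc Z) (λ t → vandermondeTerm Y X Z (Z ∸ t))  ≈⟨ ∑-cong (suc Z) reflected ⟩
  ∑ (suc Z) (reversedVandermondeTerm X Y Z)        ∎
  where
  open ≋-Reasoning
  reflected : ∀ t → t < suc Z → vandermondeTerm Y X Z (Z ∸ t) ≋ reversedVandermondeTerm X Y Z t
  reflected t t<1+Z = ⊗-cong (≡⇒≋ (cong qpow (reversedVandermondeExponent Y Z t (ℕP.≤-pred t<1+Z) Z≤Y)))
    (≋-trans (⊗-comm (qbin Y (Z ∸ t)) _)
             (⊗-congˡ (qbin Y (Z ∸ t)) (≡⇒≋ (cong (qbin X) (ℕP.m∸[m∸n]≡n (ℕP.≤-pred t<1+Z))))))

-- Contracting a cycle of centred q-binomials

qbinᶜ : ℕ → ℕ → ℤ → Poly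
qbinᶜ x y k = qbinℤ (x + y) (+ x +ℤ k)

qbinᶜ-above : ∀ x y κ → y < κ → qbinᶜ x y (+ κ) ≋ []
qbinᶜ-above x y κ y<κ = k>n⇒qbin≋[] (x + y) (x + κ) (ℕP.+-monoʳ-< x y<κ)

qbinℤ-negative : ∀ n y κ → y < κ → qbinℤ n (y ⊖ κ) ≋ []
qbinℤ-negative n y κ y<κ with ℕP.≤⇒≤″ y<κ
... | d , refl rewrite ℤP.⊖-< y<κ | ℕP.+-∸-assoc 1 (ℕP.m≤m+n y d) = ≋-refl

qbinᶜ-comm-+ : ∀ x y κ → qbinᶜ x y (+ κ) ≋ qbinᶜ y x (ℤ.- + κ)
qbinᶜ-comm-+ x y zero = begin
  qbin (x + y) (x + 0)  ≈⟨ qbin≡qbin⁺ x y refl (ℕP.+-identityʳ x) ⟩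
  qbin⁺ x y             ≈⟨ qbin⁺-comm x y ⟩
  qbin⁺ y x             ≈⟨ qbin≡qbin⁺ y x refl (ℕP.+-identityʳ y) ⟨
  qbin (y + x) (y + 0)  ∎
  where open ≋-Reasoning
qbinᶜ-comm-+ x y (suc κ) with suc κ ℕ.≤? y
... | no  κ≰y = ≋-trans (qbinᶜ-above x y (suc κ) (ℕP.≰⇒> κ≰y)) (≋-sym (qbinℤ-negative (y + x) y (suc κ) (ℕP.≰⇒> κ≰y)))
... | yes κ≤y with ℕP.≤⇒≤″ κ≤y
...   | y′ , refl = begin
  qbin (x + (suc κ + y′)) (x + suc κ)  ≈⟨ qbin≡qbin⁺ (x + suc κ) y′ (rearrangeˡ κ y′ x) refl ⟩
  qbin⁺ (x + suc κ) y′                 ≈⟨ qbin⁺-comm (x + suc κ) y′ ⟩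
  qbin⁺ y′ (x + suc κ)                 ≈⟨ qbin≡qbin⁺ y′ (x + suc κ) (rearrangeʳ κ y′ x) refl ⟨
  qbinℤ (suc κ + y′ + x) (+ y′)        ≡⟨ cong (qbinℤ (suc κ + y′ + x)) (trans (ℤP.⊖-≥ κ≤y) (cong +_ (ℕP.m+n∸m≡n (suc κ) y′))) ⟨
  qbinᶜ (suc κ + y′) x -[1+ κ ]        ∎
  where
  open ≋-Reasoning
  rearrangeˡ : ∀ κ y′ x → x + (suc κ + y′) ≡ x + suc κ + y′
  rearrangeˡ = ℕ-Solver.solve-∀
  rearrangeʳ : ∀ κ y′ x → suc κ + y′ + x ≡ y′ + (x + suc κ)
  rearrangeʳ = ℕ-Solver.solve-∀

qbinᶜ-comm : ∀ x y k → qbinᶜ x y k ≋ qbinᶜ y x (ℤ.- k)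
qbinᶜ-comm x y (+ κ)    = qbinᶜ-comm-+ x y κ
qbinᶜ-comm x y -[1+ κ ] = ≋-sym (qbinᶜ-comm-+ y x (suc κ))

-- The two q-Vandermonde expansions of [a + b, a + κ]: with ε = true the
-- factor q^(κ²) is absorbed, turning the weights into q^(s²).
contractionWeight : Bool → ℕ → ℕ → ℕ → Poly
contractionWeight true  a b s = qpow (s * s)
contractionWeight false a b s = qpow ((a ∸ s) * (b ∸ s))

squareIf : Bool → ℤ → ℕ
squareIf true  k = ∣ k ∣ * ∣ k ∣
squareIf false k = 0

squareIf-neg : ∀ ε κ → squareIf ε -[1+ κ ] ≡ squareIf ε (+ suc κ)
squareIf-neg true  κ = refl
squareIf-neg false κ = refl

contractionWeight-comm : ∀ ε a b s → contractionWeight ε b a s ≋ contractionWeight ε a b s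
contractionWeight-comm true  a b s = ≋-refl
contractionWeight-comm false a b s = ≡⇒≋ (cong qpow (ℕP.*-comm (b ∸ s) (a ∸ s)))

expansionTerm : Bool → ℕ → ℕ → ℕ → ℕ → Poly
expansionTerm ε κ a′ b′ t =
  contractionWeight ε (κ + a′) (κ + b′) (κ + t) ⊗ (qbin (b′ + (κ + κ)) (b′ ∸ t) ⊗ qbin a′ t)

qbinᶜ-recentre : ∀ κ a′ b′ → qbin ((κ + a′) + (κ + b′)) ((κ + a′) + κ) ≋ qbin (a′ + (b′ + (κ + κ))) b′
qbinᶜ-recentre κ a′ b′ = begin
  qbin ((κ + a′) + (κ + b′)) ((κ + a′) + κ)  ≈⟨ qbin≡qbin⁺ ((κ + a′) + κ) b′ (rearrangeˡ κ a′ b′) refl ⟩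
  qbin⁺ ((κ + a′) + κ) b′                    ≈⟨ qbin⁺-comm ((κ + a′) + κ) b′ ⟩
  qbin⁺ b′ ((κ + a′) + κ)                    ≈⟨ qbin≡qbin⁺ b′ ((κ + a′) + κ) (rearrangeʳ κ a′ b′) refl ⟨
  qbin (a′ + (b′ + (κ + κ))) b′              ∎
  where
  open ≋-Reasoning
  rearrangeˡ : ∀ κ a′ b′ → (κ + a′) + (κ + b′) ≡ ((κ + a′) + κ) + b′
  rearrangeˡ = ℕ-Solver.solve-∀
  rearrangeʳ : ∀ κ a′ b′ → a′ + (b′ + (κ + κ)) ≡ b′ + ((κ + a′) + κ)
  rearrangeʳ = ℕ-Solver.solve-∀

-- For k = κ ≥ 0 the centred q-binomials vanish unless their parameters are
-- at least κ, hence the offsets κ + a′, κ + b′.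
qbinᶜ-expansion : ∀ ε κ a′ b′ →
  shift (squareIf ε (+ κ)) (qbinᶜ (κ + a′) (κ + b′) (+ κ)) ≋ ∑ (suc (a′ ⊓ b′)) (expansionTerm ε κ a′ b′)
qbinᶜ-expansion false κ a′ b′ = begin
  qbin ((κ + a′) + (κ + b′)) ((κ + a′) + κ)        ≈⟨ qbinᶜ-recentre κ a′ b′ ⟩
  qbin (a′ + (b′ + (κ + κ))) b′                    ≈⟨ qVandermonde a′ (b′ + (κ + κ)) b′ ⟩
  ∑ (suc b′) v                                     ≈⟨ ∑-truncate-⊓ a′ b′ v beyond ⟩
  ∑ (suc (a′ ⊓ b′)) v                              ≈⟨ ∑-cong (suc (a′ ⊓ b′)) (λ t _ → term t) ⟩
  ∑ (suc (a′ ⊓ b′)) (expansionTerm false κ a′ b′)  ∎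
  where
  open ≋-Reasoning
  v = vandermondeTerm a′ (b′ + (κ + κ)) b′
  beyond : ∀ i → a′ < i → v i ≋ []
  beyond i a′<i = ⊗-vanishʳ (qpow ((a′ ∸ i) * (b′ ∸ i))) (⊗-vanishˡ (qbin (b′ + (κ + κ)) (b′ ∸ i)) (k>n⇒qbin≋[] a′ i a′<i))
  term : ∀ t → v t ≋ expansionTerm false κ a′ b′ t
  term t = ⊗-cong (≡⇒≋ (cong qpow (sym (cong₂ _*_ (ℕP.[m+n]∸[m+o]≡n∸o κ a′ t) (ℕP.[m+n]∸[m+o]≡n∸o κ b′ t)))))
                  (⊗-comm (qbin a′ t) (qbin (b′ + (κ + κ)) (b′ ∸ t)))
qbinᶜ-expansion true κ a′ b′ = begin
  shift (κ * κ) (qbin ((κ + a′) + (κ + b′)) ((κ + a′) + κ))  ≈⟨ shift≈qpow⊗ (κ * κ) _ ⟩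
  Q ⊗ qbin ((κ + a′) + (κ + b′)) ((κ + a′) + κ)              ≈⟨ ⊗-congʳ Q (qbinᶜ-recentre κ a′ b′) ⟩
  Q ⊗ qbin (a′ + (b′ + (κ + κ))) b′                          ≈⟨ ⊗-congʳ Q (qVandermonde-reversed a′ (b′ + (κ + κ)) b′ (ℕP.m≤m+n b′ (κ + κ))) ⟩
  Q ⊗ ∑ (suc b′) v                                           ≈⟨ ⊗-congʳ Q (∑-truncate-⊓ a′ b′ v beyond) ⟩
  Q ⊗ ∑ (suc (a′ ⊓ b′)) v                                    ≈⟨ ∑-⊗ˡ (suc (a′ ⊓ b′)) Q v ⟨
  ∑ (suc (a′ ⊓ b′)) (λ t → Q ⊗ v t)                          ≈⟨ ∑-cong (suc (a′ ⊓ b′)) (λ t _ → term t) ⟩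
  ∑ (suc (a′ ⊓ b′)) (expansionTerm true κ a′ b′)             ∎
  where
  open ≋-Reasoning
  Q = qpow (κ * κ)
  v = reversedVandermondeTerm a′ (b′ + (κ + κ)) b′
  beyond : ∀ i → a′ < i → v i ≋ []
  beyond i a′<i = ⊗-vanishʳ (qpow (i * ((b′ + (κ + κ) ∸ b′) + i))) (⊗-vanishˡ (qbin (b′ + (κ + κ)) (b′ ∸ i)) (k>n⇒qbin≋[] a′ i a′<i))
  square : ∀ κ t → κ * κ + t * ((κ + κ) + t) ≡ (κ + t) * (κ + t)
  square = ℕ-Solver.solve-∀
  exponent : ∀ t → κ * κ + t * ((b′ + (κ + κ) ∸ b′) + t) ≡ (κ + t) * (κ + t)
  exponent t = trans (cong (λ z → κ * κ + t * (z + t)) (ℕP.m+n∸m≡n b′ (κ + κ))) (square κ t)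
  term : ∀ t → (Q ⊗ v t) ≋ expansionTerm true κ a′ b′ t
  term t = begin
    Q ⊗ (qpow (t * ((b′ + (κ + κ) ∸ b′) + t)) ⊗ (qbin a′ t ⊗ B))    ≈⟨ ⊗-assoc Q _ _ ⟨
    (Q ⊗ qpow (t * ((b′ + (κ + κ) ∸ b′) + t))) ⊗ (qbin a′ t ⊗ B)    ≈⟨ ⊗-cong (qpow-+ (κ * κ) _) (⊗-comm B (qbin a′ t)) ⟨
    qpow (κ * κ + t * ((b′ + (κ + κ) ∸ b′) + t)) ⊗ (B ⊗ qbin a′ t)  ≡⟨ cong (λ e → qpow e ⊗ (B ⊗ qbin a′ t)) (exponent t) ⟩
    expansionTerm true κ a′ b′ t                                    ∎
    where
    B = qbin (b′ + (κ + κ)) (b′ ∸ t)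

edgeCoeff : Bool → ℕ → ℕ → ℕ → ℕ → ℕ → Poly
edgeCoeff ε a b u v s = contractionWeight ε a b s ⊗ (qbin (b + u) (b ∸ s) ⊗ qbin (v + a) (a ∸ s))

edgeProduct : Bool → ℕ → ℕ → ℕ → ℕ → ℤ → Poly
edgeProduct ε a b u v k = shift (squareIf ε k) (qbinᶜ a b k ⊗ (qbinᶜ b u k ⊗ qbinᶜ v a k))

contractedEdge : Bool → ℕ → ℕ → ℕ → ℕ → ℤ → Poly
contractedEdge ε a b u v k = ∑ (suc (a ⊓ b)) λ s → edgeCoeff ε a b u v s ⊗ (qbinᶜ s u k ⊗ qbinᶜ v s k)

-- With s = κ + t, b = κ + b′ and u = κ + u′:
--   [b+u, b−s] [s+u, s+κ] = [b+u, b+κ] [b+κ, b−s].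
edge-revisionˡ : ∀ κ t b′ u′ → t ≤ b′ →
  (qbin ((κ + b′) + (κ + u′)) ((κ + b′) ∸ (κ + t)) ⊗ qbin ((κ + t) + (κ + u′)) ((κ + t) + κ))
    ≋ (qbin ((κ + b′) + (κ + u′)) ((κ + b′) + κ) ⊗ qbin (b′ + (κ + κ)) (b′ ∸ t))
edge-revisionˡ κ t b′ u′ t≤b′ with ℕP.≤⇒≤″ t≤b′
... | β , refl = begin
  qbin ((κ + (t + β)) + (κ + u′)) ((κ + (t + β)) ∸ (κ + t)) ⊗ qbin ((κ + t) + (κ + u′)) ((κ + t) + κ)
    ≈⟨ ⊗-cong (qbin≡qbin⁺ β (γ + u′) (e₁ κ t β u′) (∸-offset κ t β)) (qbin≡qbin⁺ γ u′ (e₂ κ t u′) refl) ⟩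
  qbin⁺ β (γ + u′) ⊗ qbin⁺ γ u′
    ≈⟨ qbin⁺-trinomial β γ u′ ⟩
  qbin⁺ (β + γ) u′ ⊗ qbin⁺ β γ
    ≈⟨ ⊗-cong (qbin≡qbin⁺ (β + γ) u′ (e₃ κ t β u′) (e₄ κ t β)) (qbin≡qbin⁺ β γ (e₅ κ t β) (ℕP.m+n∸m≡n t β)) ⟨
  qbin ((κ + (t + β)) + (κ + u′)) ((κ + (t + β)) + κ) ⊗ qbin ((t + β) + (κ + κ)) ((t + β) ∸ t) ∎
  where
  open ≋-Reasoning
  γ = (κ + t) + κ
  e₁ : ∀ κ t β u′ → (κ + (t + β)) + (κ + u′) ≡ β + (((κ + t) + κ) + u′)
  e₁ = ℕ-Solver.solve-∀
  e₂ : ∀ κ t u′ → (κ + t) + (κ + u′) ≡ ((κ + t) + κ) + u′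
  e₂ = ℕ-Solver.solve-∀
  e₃ : ∀ κ t β u′ → (κ + (t + β)) + (κ + u′) ≡ (β + ((κ + t) + κ)) + u′
  e₃ = ℕ-Solver.solve-∀
  e₄ : ∀ κ t β → (κ + (t + β)) + κ ≡ β + ((κ + t) + κ)
  e₄ = ℕ-Solver.solve-∀
  e₅ : ∀ κ t β → (t + β) + (κ + κ) ≡ β + ((κ + t) + κ)
  e₅ = ℕ-Solver.solve-∀

-- With s = κ + t and a = κ + a′:  [v+a, a−s] [v+s, v+κ] = [v+a, v+κ] [a−κ, s−κ].
edge-revisionʳ : ∀ κ t a′ v → t ≤ a′ →
  (qbin (v + (κ + a′)) ((κ + a′) ∸ (κ + t)) ⊗ qbin (v + (κ + t)) (v + κ))
    ≋ (qbin (v + (κ + a′)) (v + κ) ⊗ qbin a′ t)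
edge-revisionʳ κ t a′ v t≤a′ with ℕP.≤⇒≤″ t≤a′
... | α , refl = begin
  qbin (v + (κ + (t + α))) ((κ + (t + α)) ∸ (κ + t)) ⊗ qbin (v + (κ + t)) (v + κ)
    ≈⟨ ⊗-cong (qbin≡qbin⁺ α (t + (v + κ)) (e₁ κ t α v) (∸-offset κ t α))
              (≋-trans (qbin≡qbin⁺ (v + κ) t (e₂ κ t v) refl) (qbin⁺-comm (v + κ) t)) ⟩
  qbin⁺ α (t + (v + κ)) ⊗ qbin⁺ t (v + κ)
    ≈⟨ qbin⁺-trinomial α t (v + κ) ⟩
  qbin⁺ (α + t) (v + κ) ⊗ qbin⁺ α t
    ≈⟨ ⊗-cong (≋-trans (qbin≡qbin⁺ (v + κ) (α + t) (e₃ κ t α v) refl) (qbin⁺-comm (v + κ) (α + t)))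
              (qbin⁺-comm t α) ⟨
  qbin (v + (κ + (t + α))) (v + κ) ⊗ qbin (t + α) t ∎
  where
  open ≋-Reasoning
  e₁ : ∀ κ t α v → v + (κ + (t + α)) ≡ α + (t + (v + κ))
  e₁ = ℕ-Solver.solve-∀
  e₂ : ∀ κ t v → v + (κ + t) ≡ (v + κ) + t
  e₂ = ℕ-Solver.solve-∀
  e₃ : ∀ κ t α v → v + (κ + (t + α)) ≡ (v + κ) + (α + t)
  e₃ = ℕ-Solver.solve-∀

edgeCoeff-expansion : ∀ ε κ a′ b′ u′ v t → t ≤ a′ ⊓ b′ →
  (edgeCoeff ε (κ + a′) (κ + b′) (κ + u′) v (κ + t) ⊗ (qbinᶜ (κ + t) (κ + u′) (+ κ) ⊗ qbinᶜ v (κ + t) (+ κ)))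
    ≋ (expansionTerm ε κ a′ b′ t ⊗ (qbin ((κ + b′) + (κ + u′)) ((κ + b′) + κ) ⊗ qbin (v + (κ + a′)) (v + κ)))
edgeCoeff-expansion ε κ a′ b′ u′ v t t≤m = begin
  (W ⊗ (qbin (b + u) (b ∸ s) ⊗ qbin (v + a) (a ∸ s))) ⊗ (qbin (s + u) (s + κ) ⊗ qbin (v + s) (v + κ))
    ≈⟨ regroup₁ W (qbin (b + u) (b ∸ s)) (qbin (v + a) (a ∸ s)) (qbin (s + u) (s + κ)) (qbin (v + s) (v + κ)) ⟩
  W ⊗ ((qbin (b + u) (b ∸ s) ⊗ qbin (s + u) (s + κ)) ⊗ (qbin (v + a) (a ∸ s) ⊗ qbin (v + s) (v + κ)))
    ≈⟨ ⊗-congʳ W (⊗-cong (edge-revisionˡ κ t b′ u′ (ℕP.≤-trans t≤m (ℕP.m⊓n≤n a′ b′)))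
                         (edge-revisionʳ κ t a′ v (ℕP.≤-trans t≤m (ℕP.m⊓n≤m a′ b′)))) ⟩
  W ⊗ ((qbin (b + u) (b + κ) ⊗ qbin (b′ + (κ + κ)) (b′ ∸ t)) ⊗ (qbin (v + a) (v + κ) ⊗ qbin a′ t))
    ≈⟨ regroup₂ W (qbin (b + u) (b + κ)) (qbin (b′ + (κ + κ)) (b′ ∸ t)) (qbin (v + a) (v + κ)) (qbin a′ t) ⟩
  expansionTerm ε κ a′ b′ t ⊗ (qbin (b + u) (b + κ) ⊗ qbin (v + a) (v + κ)) ∎
  where
  open ≋-Reasoning
  a = κ + a′
  b = κ + b′
  u = κ + u′
  s = κ + t
  W = contractionWeight ε a b s
  regroup₁ : ∀ w a b c d → ((w ⊗ (a ⊗ b)) ⊗ (c ⊗ d)) ≋ (w ⊗ ((a ⊗ c) ⊗ (b ⊗ d)))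
  regroup₁ = solve-∀ poly-ring
  regroup₂ : ∀ w c₁ x c₂ y → (w ⊗ ((c₁ ⊗ x) ⊗ (c₂ ⊗ y))) ≋ ((w ⊗ (x ⊗ y)) ⊗ (c₁ ⊗ c₂))
  regroup₂ = solve-∀ poly-ring

edge-contraction-offset : ∀ ε κ a′ b′ u′ v →
  edgeProduct ε (κ + a′) (κ + b′) (κ + u′) v (+ κ) ≋ contractedEdge ε (κ + a′) (κ + b′) (κ + u′) v (+ κ)
edge-contraction-offset ε κ a′ b′ u′ v = begin
  shift (squareIf ε (+ κ)) (qbinᶜ a b (+ κ) ⊗ F)
    ≈⟨ shift-⊗ (squareIf ε (+ κ)) (qbinᶜ a b (+ κ)) F ⟩
  shift (squareIf ε (+ κ)) (qbinᶜ a b (+ κ)) ⊗ F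
    ≈⟨ ⊗-congˡ F (qbinᶜ-expansion ε κ a′ b′) ⟩
  ∑ (suc m) (expansionTerm ε κ a′ b′) ⊗ F
    ≈⟨ ∑-⊗ʳ (suc m) F (expansionTerm ε κ a′ b′) ⟨
  ∑ (suc m) (λ t → expansionTerm ε κ a′ b′ t ⊗ F)
    ≈⟨ ∑-cong (suc m) (λ t t<1+m → edgeCoeff-expansion ε κ a′ b′ u′ v t (ℕP.≤-pred t<1+m)) ⟨
  ∑ (suc m) (λ t → G (κ + t))
    ≈⟨ ∑-dropHead κ (suc m) G below-κ ⟨
  ∑ (κ + suc m) G
    ≡⟨ cong (λ n → ∑ n G) (trans (ℕP.+-suc κ m) (cong suc (ℕP.+-distribˡ-⊓ κ a′ b′))) ⟩
  ∑ (suc (a ⊓ b)) G ∎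
  where
  open ≋-Reasoning
  a = κ + a′
  b = κ + b′
  u = κ + u′
  m = a′ ⊓ b′
  F = qbin (b + u) (b + κ) ⊗ qbin (v + a) (v + κ)
  G : ℕ → Poly
  G s = edgeCoeff ε a b u v s ⊗ (qbinᶜ s u (+ κ) ⊗ qbinᶜ v s (+ κ))
  below-κ : ∀ s → s < κ → G s ≋ []
  below-κ s s<κ = ⊗-vanishʳ (edgeCoeff ε a b u v s) (⊗-vanishʳ (qbinᶜ s u (+ κ)) (qbinᶜ-above v s κ s<κ))

contractedEdge-vanishes : ∀ ε a b u v k → (∀ s → s ≤ a ⊓ b → (qbinᶜ s u k ⊗ qbinᶜ v s k) ≋ []) →
                          contractedEdge ε a b u v k ≋ []
contractedEdge-vanishes ε a b u v k vanish =
  ∑-zero (suc (a ⊓ b)) λ s s<1+m → ⊗-vanishʳ (edgeCoeff ε a b u v s) (vanish s (ℕP.≤-pred s<1+m))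

edgeProduct-vanishes : ∀ ε a b u v k → (qbinᶜ a b k ⊗ (qbinᶜ b u k ⊗ qbinᶜ v a k)) ≋ [] → edgeProduct ε a b u v k ≋ []
edgeProduct-vanishes ε a b u v k vanish = ≋-trans (shift-cong (squareIf ε k) vanish) (shift-zero (squareIf ε k))

edge-contraction-+ : ∀ ε a b u v κ → edgeProduct ε a b u v (+ κ) ≋ contractedEdge ε a b u v (+ κ)
edge-contraction-+ ε a b u v κ with κ ℕ.≤? u | κ ℕ.≤? a | κ ℕ.≤? b
... | no κ≰u | _ | _ = ≋-trans
  (edgeProduct-vanishes ε a b u v k (⊗-vanishʳ (qbinᶜ a b k) (⊗-vanishˡ (qbinᶜ v a k) (qbinᶜ-above b u κ (ℕP.≰⇒> κ≰u)))))
  (≋-sym (contractedEdge-vanishes ε a b u v k λ s _ → ⊗-vanishˡ (qbinᶜ v s k) (qbinᶜ-above s u κ (ℕP.≰⇒> κ≰u))))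
  where k = + κ
... | yes _ | no κ≰a | _ = ≋-trans
  (edgeProduct-vanishes ε a b u v k (⊗-vanishʳ (qbinᶜ a b k) (⊗-vanishʳ (qbinᶜ b u k) (qbinᶜ-above v a κ (ℕP.≰⇒> κ≰a)))))
  (≋-sym (contractedEdge-vanishes ε a b u v k λ s s≤m →
    ⊗-vanishʳ (qbinᶜ s u k) (qbinᶜ-above v s κ (ℕP.≤-<-trans (ℕP.≤-trans s≤m (ℕP.m⊓n≤m a b)) (ℕP.≰⇒> κ≰a)))))
  where k = + κ
... | yes _ | yes _ | no κ≰b = ≋-trans
  (edgeProduct-vanishes ε a b u v k (⊗-vanishˡ (qbinᶜ b u k ⊗ qbinᶜ v a k) (qbinᶜ-above a b κ (ℕP.≰⇒> κ≰b))))
  (≋-sym (contractedEdge-vanishes ε a b u v k λ s s≤m →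
    ⊗-vanishʳ (qbinᶜ s u k) (qbinᶜ-above v s κ (ℕP.≤-<-trans (ℕP.≤-trans s≤m (ℕP.m⊓n≤n a b)) (ℕP.≰⇒> κ≰b)))))
  where k = + κ
... | yes κ≤u | yes κ≤a | yes κ≤b with ℕP.≤⇒≤″ κ≤a | ℕP.≤⇒≤″ κ≤b | ℕP.≤⇒≤″ κ≤u
...   | a′ , refl | b′ , refl | u′ , refl = edge-contraction-offset ε κ a′ b′ u′ v

edgeCoeff-mirror : ∀ ε a b u v s → edgeCoeff ε b a v u s ≋ edgeCoeff ε a b u v s
edgeCoeff-mirror ε a b u v s = ⊗-cong (contractionWeight-comm ε a b s) (begin
  qbin (a + v) (a ∸ s) ⊗ qbin (u + b) (b ∸ s)  ≈⟨ ⊗-comm (qbin (a + v) (a ∸ s)) (qbin (u + b) (b ∸ s)) ⟩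
  qbin (u + b) (b ∸ s) ⊗ qbin (a + v) (a ∸ s)  ≡⟨ cong₂ (λ n n′ → qbin n (b ∸ s) ⊗ qbin n′ (a ∸ s)) (ℕP.+-comm u b) (ℕP.+-comm a v) ⟩
  qbin (b + u) (b ∸ s) ⊗ qbin (v + a) (a ∸ s)  ∎)
  where open ≋-Reasoning

-- For k < 0, qbinᶜ-comm reverses the path v → a → b → u and negates k.
edge-contraction : ∀ ε a b u v k → edgeProduct ε a b u v k ≋ contractedEdge ε a b u v k
edge-contraction ε a b u v (+ κ)    = edge-contraction-+ ε a b u v κ
edge-contraction ε a b u v -[1+ κ ] = begin
  shift (squareIf ε k) (qbinᶜ a b k ⊗ (qbinᶜ b u k ⊗ qbinᶜ v a k))
    ≈⟨ shift-cong (squareIf ε k) (⊗-cong (qbinᶜ-comm a b k)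
         (≋-trans (⊗-cong (qbinᶜ-comm b u k) (qbinᶜ-comm v a k)) (⊗-comm (qbinᶜ u b k′) (qbinᶜ a v k′)))) ⟩
  shift (squareIf ε k) (qbinᶜ b a k′ ⊗ (qbinᶜ a v k′ ⊗ qbinᶜ u b k′))
    ≡⟨ cong (λ e → shift e (qbinᶜ b a k′ ⊗ (qbinᶜ a v k′ ⊗ qbinᶜ u b k′))) (squareIf-neg ε κ) ⟩
  edgeProduct ε b a v u k′
    ≈⟨ edge-contraction-+ ε b a v u (suc κ) ⟩
  contractedEdge ε b a v u k′
    ≡⟨ cong (λ m → ∑ (suc m) (λ s → edgeCoeff ε b a v u s ⊗ (qbinᶜ s v k′ ⊗ qbinᶜ u s k′))) (ℕP.⊓-comm b a) ⟩
  ∑ (suc (a ⊓ b)) (λ s → edgeCoeff ε b a v u s ⊗ (qbinᶜ s v k′ ⊗ qbinᶜ u s k′))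
    ≈⟨ ∑-cong (suc (a ⊓ b)) (λ s _ → ⊗-cong (edgeCoeff-mirror ε a b u v s)
         (≋-trans (⊗-comm (qbinᶜ s v k′) (qbinᶜ u s k′)) (≋-sym (⊗-cong (qbinᶜ-comm s u k) (qbinᶜ-comm v s k))))) ⟩
  contractedEdge ε a b u v k ∎
  where
  open ≋-Reasoning
  k = -[1+ κ ]
  k′ = + suc κ

loopCoeff : Bool → ℕ → ℕ → ℕ → Poly
loopCoeff ε a v s = contractionWeight ε a v s ⊗ (qbin (a + v) (a ∸ s) ⊗ qbin (v + s) (v ∸ s))

loopProduct : Bool → ℕ → ℕ → ℤ → Poly
loopProduct ε a v k = shift (squareIf ε k) (qbinᶜ a v k ⊗ qbinᶜ v a k)

contractedLoop : Bool → ℕ → ℕ → ℤ → Poly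
contractedLoop ε a v k = ∑ (suc (a ⊓ v)) λ s → loopCoeff ε a v s ⊗ qbinᶜ s s k

-- With s = κ + t, a = κ + a′ and v = κ + v′:
--   [a+v, a−s] [v+s, v−s] [2s, s+κ] = [v+κ, v−s] [a−κ, s−κ] [v+a, v+κ].
loop-revision : ∀ κ t a′ v′ → t ≤ a′ → t ≤ v′ →
  ((qbin ((κ + a′) + (κ + v′)) ((κ + a′) ∸ (κ + t)) ⊗ qbin ((κ + v′) + (κ + t)) ((κ + v′) ∸ (κ + t)))
      ⊗ qbin ((κ + t) + (κ + t)) ((κ + t) + κ))
    ≋ ((qbin (v′ + (κ + κ)) (v′ ∸ t) ⊗ qbin a′ t) ⊗ qbin ((κ + v′) + (κ + a′)) ((κ + v′) + κ))
loop-revision κ t a′ v′ t≤a′ t≤v′ with ℕP.≤⇒≤″ t≤a′ | ℕP.≤⇒≤″ t≤v′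
... | α , refl | β , refl = begin
  (X₁ ⊗ X₂) ⊗ X₃
    ≈⟨ ⊗-assoc X₁ X₂ X₃ ⟩
  X₁ ⊗ (X₂ ⊗ X₃)
    ≈⟨ ⊗-cong (qbin≡qbin⁺ α (β + (γ + t)) (e₁ κ t α β) (∸-offset κ t α))
              (⊗-cong (qbin≡qbin⁺ β (γ + t) (e₂ κ t β) (∸-offset κ t β)) (qbin≡qbin⁺ γ t (e₃ κ t) refl)) ⟩
  qbin⁺ α (β + (γ + t)) ⊗ (qbin⁺ β (γ + t) ⊗ qbin⁺ γ t)
    ≈⟨ qbin⁺-quadrinomial α β γ t ⟩
  qbin⁺ (β + γ) (α + t) ⊗ (qbin⁺ β γ ⊗ qbin⁺ α t)
    ≈⟨ ⊗-cong (qbin≡qbin⁺ (β + γ) (α + t) (e₄ κ t α β) (e₅ κ t β))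
              (⊗-cong (qbin≡qbin⁺ β γ (e₆ κ t β) (ℕP.m+n∸m≡n t β)) (qbin⁺-comm t α)) ⟨
  Y₃ ⊗ (Y₁ ⊗ Y₂)
    ≈⟨ ⊗-comm Y₃ (Y₁ ⊗ Y₂) ⟩
  (Y₁ ⊗ Y₂) ⊗ Y₃ ∎
  where
  open ≋-Reasoning
  γ = (κ + t) + κ
  X₁ = qbin ((κ + (t + α)) + (κ + (t + β))) ((κ + (t + α)) ∸ (κ + t))
  X₂ = qbin ((κ + (t + β)) + (κ + t)) ((κ + (t + β)) ∸ (κ + t))
  X₃ = qbin ((κ + t) + (κ + t)) ((κ + t) + κ)
  Y₁ = qbin ((t + β) + (κ + κ)) ((t + β) ∸ t)
  Y₂ = qbin (t + α) t
  Y₃ = qbin ((κ + (t + β)) + (κ + (t + α))) ((κ + (t + β)) + κ)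
  e₁ : ∀ κ t α β → (κ + (t + α)) + (κ + (t + β)) ≡ α + (β + (((κ + t) + κ) + t))
  e₁ = ℕ-Solver.solve-∀
  e₂ : ∀ κ t β → (κ + (t + β)) + (κ + t) ≡ β + (((κ + t) + κ) + t)
  e₂ = ℕ-Solver.solve-∀
  e₃ : ∀ κ t → (κ + t) + (κ + t) ≡ ((κ + t) + κ) + t
  e₃ = ℕ-Solver.solve-∀
  e₄ : ∀ κ t α β → (κ + (t + β)) + (κ + (t + α)) ≡ (β + ((κ + t) + κ)) + (α + t)
  e₄ = ℕ-Solver.solve-∀
  e₅ : ∀ κ t β → (κ + (t + β)) + κ ≡ β + ((κ + t) + κ)
  e₅ = ℕ-Solver.solve-∀
  e₆ : ∀ κ t β → (t + β) + (κ + κ) ≡ β + ((κ + t) + κ)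
  e₆ = ℕ-Solver.solve-∀

loopCoeff-expansion : ∀ ε κ a′ v′ t → t ≤ a′ ⊓ v′ →
  (loopCoeff ε (κ + a′) (κ + v′) (κ + t) ⊗ qbinᶜ (κ + t) (κ + t) (+ κ))
    ≋ (expansionTerm ε κ a′ v′ t ⊗ qbin ((κ + v′) + (κ + a′)) ((κ + v′) + κ))
loopCoeff-expansion ε κ a′ v′ t t≤m = begin
  (W ⊗ (A ⊗ B)) ⊗ D  ≈⟨ regroup W A B D ⟩
  W ⊗ ((A ⊗ B) ⊗ D)  ≈⟨ ⊗-congʳ W (loop-revision κ t a′ v′ (ℕP.≤-trans t≤m (ℕP.m⊓n≤m a′ v′))
                                                                                            (ℕP.≤-trans t≤m (ℕP.m⊓n≤n a′ v′))) ⟩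
  W ⊗ ((qbin (v′ + (κ + κ)) (v′ ∸ t) ⊗ qbin a′ t) ⊗ F)  ≈⟨ ⊗-assoc W (qbin (v′ + (κ + κ)) (v′ ∸ t) ⊗ qbin a′ t) F ⟨
  expansionTerm ε κ a′ v′ t ⊗ F                         ∎
  where
  open ≋-Reasoning
  a = κ + a′
  v = κ + v′
  s = κ + t
  W = contractionWeight ε a v s
  A = qbin (a + v) (a ∸ s)
  B = qbin (v + s) (v ∸ s)
  D = qbin (s + s) (s + κ)
  F = qbin (v + a) (v + κ)
  regroup : ∀ w a b d → ((w ⊗ (a ⊗ b)) ⊗ d) ≋ (w ⊗ ((a ⊗ b) ⊗ d))
  regroup = solve-∀ poly-ring

loop-contraction-offset : ∀ ε κ a′ v′ →
  loopProduct ε (κ + a′) (κ + v′) (+ κ) ≋ contractedLoop ε (κ + a′) (κ + v′) (+ κ)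
loop-contraction-offset ε κ a′ v′ = begin
  shift (squareIf ε (+ κ)) (qbinᶜ a v (+ κ) ⊗ F)
    ≈⟨ shift-⊗ (squareIf ε (+ κ)) (qbinᶜ a v (+ κ)) F ⟩
  shift (squareIf ε (+ κ)) (qbinᶜ a v (+ κ)) ⊗ F
    ≈⟨ ⊗-congˡ F (qbinᶜ-expansion ε κ a′ v′) ⟩
  ∑ (suc m) (expansionTerm ε κ a′ v′) ⊗ F
    ≈⟨ ∑-⊗ʳ (suc m) F (expansionTerm ε κ a′ v′) ⟨
  ∑ (suc m) (λ t → expansionTerm ε κ a′ v′ t ⊗ F)
    ≈⟨ ∑-cong (suc m) (λ t t<1+m → loopCoeff-expansion ε κ a′ v′ t (ℕP.≤-pred t<1+m)) ⟨
  ∑ (suc m) (λ t → G (κ + t))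
    ≈⟨ ∑-dropHead κ (suc m) G (λ s s<κ → ⊗-vanishʳ (loopCoeff ε a v s) (qbinᶜ-above s s κ s<κ)) ⟨
  ∑ (κ + suc m) G
    ≡⟨ cong (λ n → ∑ n G) (trans (ℕP.+-suc κ m) (cong suc (ℕP.+-distribˡ-⊓ κ a′ v′))) ⟩
  ∑ (suc (a ⊓ v)) G ∎
  where
  open ≋-Reasoning
  a = κ + a′
  v = κ + v′
  m = a′ ⊓ v′
  F = qbin (v + a) (v + κ)
  G : ℕ → Poly
  G s = loopCoeff ε a v s ⊗ qbinᶜ s s (+ κ)

contractedLoop-vanishes : ∀ ε a v κ → (∀ s → s ≤ a ⊓ v → s < κ) → contractedLoop ε a v (+ κ) ≋ []
contractedLoop-vanishes ε a v κ below = ∑-zero (suc (a ⊓ v)) λ s s<1+m →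
  ⊗-vanishʳ (loopCoeff ε a v s) (qbinᶜ-above s s κ (below s (ℕP.≤-pred s<1+m)))

loop-contraction-+ : ∀ ε a v κ → loopProduct ε a v (+ κ) ≋ contractedLoop ε a v (+ κ)
loop-contraction-+ ε a v κ with κ ℕ.≤? v | κ ℕ.≤? a
... | no κ≰v | _ = ≋-trans
  (≋-trans (shift-cong (squareIf ε (+ κ)) (⊗-vanishˡ (qbinᶜ v a (+ κ)) (qbinᶜ-above a v κ (ℕP.≰⇒> κ≰v))))
           (shift-zero (squareIf ε (+ κ))))
  (≋-sym (contractedLoop-vanishes ε a v κ λ s s≤m → ℕP.≤-<-trans (ℕP.≤-trans s≤m (ℕP.m⊓n≤n a v)) (ℕP.≰⇒> κ≰v)))
... | yes _ | no κ≰a = ≋-trans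
  (≋-trans (shift-cong (squareIf ε (+ κ)) (⊗-vanishʳ (qbinᶜ a v (+ κ)) (qbinᶜ-above v a κ (ℕP.≰⇒> κ≰a))))
           (shift-zero (squareIf ε (+ κ))))
  (≋-sym (contractedLoop-vanishes ε a v κ λ s s≤m → ℕP.≤-<-trans (ℕP.≤-trans s≤m (ℕP.m⊓n≤m a v)) (ℕP.≰⇒> κ≰a)))
... | yes κ≤v | yes κ≤a with ℕP.≤⇒≤″ κ≤a | ℕP.≤⇒≤″ κ≤v
...   | a′ , refl | v′ , refl = loop-contraction-offset ε κ a′ v′

loop-revision-swap : ∀ a v s → s ≤ a → s ≤ v →
  (qbin (v + a) (v ∸ s) ⊗ qbin (a + s) (a ∸ s)) ≋ (qbin (a + v) (a ∸ s) ⊗ qbin (v + s) (v ∸ s))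
loop-revision-swap a v s s≤a s≤v with ℕP.≤⇒≤″ s≤a | ℕP.≤⇒≤″ s≤v
... | α , refl | β , refl = begin
  qbin ((s + β) + (s + α)) ((s + β) ∸ s) ⊗ qbin ((s + α) + s) ((s + α) ∸ s)
    ≈⟨ ⊗-cong (qbin≡qbin⁺ β (α + (s + s)) (e₁ s α β) (ℕP.m+n∸m≡n s β)) (qbin≡qbin⁺ α (s + s) (e₂ s α) (ℕP.m+n∸m≡n s α)) ⟩
  qbin⁺ β (α + (s + s)) ⊗ qbin⁺ α (s + s)  ≈⟨ qbin⁺-trinomial β α (s + s) ⟩
  qbin⁺ (β + α) (s + s) ⊗ qbin⁺ β α        ≈⟨ ⊗-cong (≡⇒≋ (cong (λ x → qbin⁺ x (s + s)) (ℕP.+-comm β α))) (qbin⁺-comm β α) ⟩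
  qbin⁺ (α + β) (s + s) ⊗ qbin⁺ α β        ≈⟨ qbin⁺-trinomial α β (s + s) ⟨
  qbin⁺ α (β + (s + s)) ⊗ qbin⁺ β (s + s)
    ≈⟨ ⊗-cong (qbin≡qbin⁺ α (β + (s + s)) (e₁ s β α) (ℕP.m+n∸m≡n s α)) (qbin≡qbin⁺ β (s + s) (e₂ s β) (ℕP.m+n∸m≡n s β)) ⟨
  qbin ((s + α) + (s + β)) ((s + α) ∸ s) ⊗ qbin ((s + β) + s) ((s + β) ∸ s) ∎
  where
  open ≋-Reasoning
  e₁ : ∀ s α β → (s + β) + (s + α) ≡ β + (α + (s + s))
  e₁ = ℕ-Solver.solve-∀
  e₂ : ∀ s α → (s + α) + s ≡ α + (s + s)
  e₂ = ℕ-Solver.solve-∀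

loopCoeff-mirror : ∀ ε a v s → s ≤ a ⊓ v → loopCoeff ε v a s ≋ loopCoeff ε a v s
loopCoeff-mirror ε a v s s≤m = ⊗-cong (contractionWeight-comm ε a v s)
  (loop-revision-swap a v s (ℕP.≤-trans s≤m (ℕP.m⊓n≤m a v)) (ℕP.≤-trans s≤m (ℕP.m⊓n≤n a v)))

loop-contraction : ∀ ε a v k → loopProduct ε a v k ≋ contractedLoop ε a v k
loop-contraction ε a v (+ κ)    = loop-contraction-+ ε a v κ
loop-contraction ε a v -[1+ κ ] = begin
  shift (squareIf ε k) (qbinᶜ a v k ⊗ qbinᶜ v a k)
    ≈⟨ shift-cong (squareIf ε k) (⊗-cong (qbinᶜ-comm a v k) (qbinᶜ-comm v a k)) ⟩
  shift (squareIf ε k) (qbinᶜ v a k′ ⊗ qbinᶜ a v k′)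
    ≡⟨ cong (λ e → shift e (qbinᶜ v a k′ ⊗ qbinᶜ a v k′)) (squareIf-neg ε κ) ⟩
  loopProduct ε v a k′
    ≈⟨ loop-contraction-+ ε v a (suc κ) ⟩
  contractedLoop ε v a k′
    ≡⟨ cong (λ m → ∑ (suc m) (λ s → loopCoeff ε v a s ⊗ qbinᶜ s s k′)) (ℕP.⊓-comm v a) ⟩
  ∑ (suc (a ⊓ v)) (λ s → loopCoeff ε v a s ⊗ qbinᶜ s s k′)
    ≈⟨ ∑-cong (suc (a ⊓ v)) (λ s s<1+m → ⊗-cong (loopCoeff-mirror ε a v s (ℕP.≤-pred s<1+m)) (≋-sym (qbinᶜ-comm s s k))) ⟩
  contractedLoop ε a v k ∎
  where
  open ≋-Reasoning
  k = -[1+ κ ]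
  k′ = + suc κ

-- Alternating sums of q-binomials

signedShift : ℕ → ℤ → Poly → Poly
signedShift c σ p = shift c (scale σ p)

signedShift≈⊗ : ∀ c σ p → signedShift c σ p ≋ ((qpow c ⊗ cst σ) ⊗ p)
signedShift≈⊗ c σ p = begin
  shift c (scale σ p)   ≈⟨ shift≈qpow⊗ c (scale σ p) ⟩
  qpow c ⊗ scale σ p    ≈⟨ ⊗-congʳ (qpow c) (scale≈cst⊗ σ p) ⟩
  qpow c ⊗ (cst σ ⊗ p)  ≈⟨ ⊗-assoc (qpow c) (cst σ) p ⟨
  (qpow c ⊗ cst σ) ⊗ p  ∎
  where open ≋-Reasoning

signedShift-cong : ∀ c σ {p r} → p ≋ r → signedShift c σ p ≋ signedShift c σ r
signedShift-cong c σ e = shift-cong c (scale-cong σ e)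

signedShift-⊗ : ∀ c σ p r → signedShift c σ (p ⊗ r) ≋ (p ⊗ signedShift c σ r)
signedShift-⊗ c σ p r = begin
  signedShift c σ (p ⊗ r)     ≈⟨ signedShift≈⊗ c σ (p ⊗ r) ⟩
  (qpow c ⊗ cst σ) ⊗ (p ⊗ r)  ≈⟨ swap (qpow c ⊗ cst σ) p r ⟩
  p ⊗ ((qpow c ⊗ cst σ) ⊗ r)  ≈⟨ ⊗-congʳ p (signedShift≈⊗ c σ r) ⟨
  p ⊗ signedShift c σ r       ∎
  where
  open ≋-Reasoning
  swap : ∀ w p r → (w ⊗ (p ⊗ r)) ≋ (p ⊗ (w ⊗ r))
  swap = solve-∀ poly-ring

signedShift-⊕ : ∀ c σ p r → signedShift c σ (p ⊕ r) ≋ (signedShift c σ p ⊕ signedShift c σ r)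
signedShift-⊕ c σ p r = begin
  signedShift c σ (p ⊕ r)                          ≈⟨ signedShift≈⊗ c σ (p ⊕ r) ⟩
  (qpow c ⊗ cst σ) ⊗ (p ⊕ r)                       ≈⟨ ⊗-distribˡ (qpow c ⊗ cst σ) p r ⟩
  ((qpow c ⊗ cst σ) ⊗ p) ⊕ ((qpow c ⊗ cst σ) ⊗ r)  ≈⟨ ⊕-cong (signedShift≈⊗ c σ p) (signedShift≈⊗ c σ r) ⟨
  signedShift c σ p ⊕ signedShift c σ r            ∎
  where open ≋-Reasoning

signedShift-∑ : ∀ c σ n f → signedShift c σ (∑ n f) ≋ ∑ n (λ s → signedShift c σ (f s))
signedShift-∑ c σ zero    f = shift-zero c
signedShift-∑ c σ (suc n) f = ≋-trans (signedShift-⊕ c σ (f 0) (∑ n (f ∘ suc)))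
                                      (⊕-congʳ (signedShift c σ (f 0)) (signedShift-∑ c σ n (f ∘ suc)))

alternate : ℤ → Poly → Poly
alternate k = signedShift (choose2 k) (sgn k)

suc-C2 : ∀ n → suc n C 2 ≡ n + n C 2
suc-C2 n = trans (sym (nCk+nC[k+1]≡[n+1]C[k+1] n 1)) (cong (_+ n C 2) (nC1≡n n))

choose2-suc : ∀ w → + choose2 (w +ℤ + 1) ≡ + choose2 w +ℤ w
choose2-suc (+ n) = cong +_ (begin
  (n + 1) C 2  ≡⟨ cong (_C 2) (ℕP.+-comm n 1) ⟩
  suc n C 2    ≡⟨ suc-C2 n ⟩
  n + n C 2    ≡⟨ ℕP.+-comm n (n C 2) ⟩
  n C 2 + n    ∎)
  where open ≡-Reasoning
choose2-suc -[1+ zero ]  = refl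
choose2-suc -[1+ suc n ] = begin
  + (suc (suc n) C 2)                                     ≡⟨ cancel (+ suc (suc n)) (+ (suc (suc n) C 2)) ⟩
  (+ suc (suc n) +ℤ + (suc (suc n) C 2)) +ℤ -[1+ suc n ]  ≡⟨ cong (λ c → + c +ℤ -[1+ suc n ]) (suc-C2 (suc (suc n))) ⟨
  + (suc (suc (suc n)) C 2) +ℤ -[1+ suc n ]               ∎
  where
  open ≡-Reasoning
  cancel : ∀ a c → c ≡ (a +ℤ c) +ℤ ℤ.- a
  cancel = ℤ-Solver.solve-∀

sgn-suc : ∀ w → sgn (w +ℤ + 1) ≡ ℤ.- sgn w
sgn-suc (+ n)        = trans (cong (λ m → sgn (+ m)) (ℕP.+-comm n 1)) (ℤP.-1*i≡-i _)
sgn-suc -[1+ zero ]  = refl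
sgn-suc -[1+ suc n ] = sym (trans (cong ℤ.-_ (ℤP.-1*i≡-i (sgn -[1+ n ]))) (ℤP.neg-involutive _))

choose2-shift : ∀ w m e → + m ≡ w +ℤ + e → choose2 w + m ≡ e + choose2 (w +ℤ + 1)
choose2-shift w m e m≡w+e = ℤP.+-injective (begin
  + choose2 w +ℤ + m           ≡⟨ cong (+ choose2 w +ℤ_) m≡w+e ⟩
  + choose2 w +ℤ (w +ℤ + e)    ≡⟨ rearrange (+ choose2 w) w (+ e) ⟩
  + e +ℤ (+ choose2 w +ℤ w)    ≡⟨ cong (+ e +ℤ_) (choose2-suc w) ⟨
  + e +ℤ + choose2 (w +ℤ + 1)  ∎)
  where
  open ≡-Reasoning
  rearrange : ∀ c w e → c +ℤ (w +ℤ e) ≡ e +ℤ (c +ℤ w)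
  rearrange = ℤ-Solver.solve-∀

alternate-shift : ∀ w m e p → + m ≡ w +ℤ + e → alternate w (shift m p) ≋ (neg (qpow e) ⊗ alternate (w +ℤ + 1) p)
alternate-shift w m e p m≡w+e = begin
  alternate w (shift m p)                                ≈⟨ signedShift≈⊗ (choose2 w) (sgn w) (shift m p) ⟩
  (qpow (choose2 w) ⊗ cst (sgn w)) ⊗ shift m p           ≈⟨ ⊗-congʳ (qpow (choose2 w) ⊗ cst (sgn w)) (shift≈qpow⊗ m p) ⟩
  (qpow (choose2 w) ⊗ cst (sgn w)) ⊗ (qpow m ⊗ p)        ≈⟨ gather (qpow (choose2 w)) (cst (sgn w)) (qpow m) p ⟩
  ((qpow (choose2 w) ⊗ qpow m) ⊗ cst (sgn w)) ⊗ p        ≈⟨ ⊗-congˡ p (⊗-congˡ (cst (sgn w)) (qpow-+ (choose2 w) m)) ⟨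
  (qpow (choose2 w + m) ⊗ cst (sgn w)) ⊗ p               ≡⟨ cong (λ c → (qpow c ⊗ cst (sgn w)) ⊗ p) (choose2-shift w m e m≡w+e) ⟩
  (qpow (e + C′) ⊗ cst (sgn w)) ⊗ p                      ≈⟨ ⊗-congˡ p (⊗-congˡ (cst (sgn w)) (qpow-+ e C′)) ⟩
  ((qpow e ⊗ qpow C′) ⊗ cst (sgn w)) ⊗ p                 ≈⟨ flip (qpow e) (qpow C′) (cst (sgn w)) p ⟩
  neg (qpow e) ⊗ ((qpow C′ ⊗ neg (cst (sgn w))) ⊗ p)     ≈⟨ ⊗-congʳ (neg (qpow e)) (⊗-congˡ p (⊗-congʳ (qpow C′) sign)) ⟨
  neg (qpow e) ⊗ ((qpow C′ ⊗ cst (sgn (w +ℤ + 1))) ⊗ p)  ≈⟨ ⊗-congʳ (neg (qpow e)) (signedShift≈⊗ C′ (sgn (w +ℤ + 1)) p) ⟨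
  neg (qpow e) ⊗ alternate (w +ℤ + 1) p                  ∎
  where
  open ≋-Reasoning
  C′ = choose2 (w +ℤ + 1)
  sign : cst (sgn (w +ℤ + 1)) ≋ neg (cst (sgn w))
  sign = ≋-trans (≡⇒≋ (cong cst (sgn-suc w))) (cst-neg (sgn w))
  gather : ∀ Q S P p → ((Q ⊗ S) ⊗ (P ⊗ p)) ≋ (((Q ⊗ P) ⊗ S) ⊗ p)
  gather = solve-∀ poly-ring
  flip : ∀ Qe Qc S p → (((Qe ⊗ Qc) ⊗ S) ⊗ p) ≋ (neg Qe ⊗ ((Qc ⊗ neg S) ⊗ p))
  flip = solve-∀ poly-ring

alternatingQbinSum : ℕ → ℤ → Poly
alternatingQbinSum N z = ∑ (suc N) λ i → alternate (+ i +ℤ z) (qbin N i)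

alternate-qbin-head : ∀ N z e → + e ≡ ℤ.- z +ℤ + 1 →
  alternate (+ 0 +ℤ (z ℤ.- + 1)) (qbin (suc N) 0) ≋ (neg (qpow e) ⊗ alternate (+ 0 +ℤ z) (qbin N 0))
alternate-qbin-head N z e e≡1-z = ≋-trans
  (alternate-shift (+ 0 +ℤ (z ℤ.- + 1)) 0 e one (trans (index z) (cong ((+ 0 +ℤ (z ℤ.- + 1)) +ℤ_) (sym e≡1-z))))
  (⊗-congʳ (neg (qpow e)) (≡⇒≋ (cong (λ w → alternate w one) (index′ z))))
  where
  index : ∀ z → + 0 ≡ (+ 0 +ℤ (z ℤ.- + 1)) +ℤ (ℤ.- z +ℤ + 1)
  index = ℤ-Solver.solve-∀
  index′ : ∀ z → (+ 0 +ℤ (z ℤ.- + 1)) +ℤ + 1 ≡ + 0 +ℤ z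
  index′ = ℤ-Solver.solve-∀

alternate-qbin-pascal : ∀ N z e i → + e ≡ ℤ.- z +ℤ + 1 →
  alternate (+ suc i +ℤ (z ℤ.- + 1)) (qbin (suc N) (suc i))
    ≋ (alternate (+ i +ℤ z) (qbin N i) ⊕ (neg (qpow e) ⊗ alternate (+ suc i +ℤ z) (qbin N (suc i))))
alternate-qbin-pascal N z e i e≡1-z = begin
  alternate (+ suc i +ℤ (z ℤ.- + 1)) (qbin N i ⊕ shift (suc i) (qbin N (suc i)))
    ≡⟨ cong (λ w → alternate w (qbin N i ⊕ shift (suc i) (qbin N (suc i)))) (index (+ i) z) ⟩
  alternate w (qbin N i ⊕ shift (suc i) (qbin N (suc i)))
    ≈⟨ signedShift-⊕ (choose2 w) (sgn w) (qbin N i) (shift (suc i) (qbin N (suc i))) ⟩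
  alternate w (qbin N i) ⊕ alternate w (shift (suc i) (qbin N (suc i)))
    ≈⟨ ⊕-congʳ (alternate w (qbin N i))
         (alternate-shift w (suc i) e (qbin N (suc i)) (trans (index′ (+ i) z) (cong (w +ℤ_) (sym e≡1-z)))) ⟩
  alternate w (qbin N i) ⊕ (neg (qpow e) ⊗ alternate (w +ℤ + 1) (qbin N (suc i)))
    ≡⟨ cong (λ w′ → alternate w (qbin N i) ⊕ (neg (qpow e) ⊗ alternate w′ (qbin N (suc i)))) (index″ (+ i) z) ⟩
  alternate w (qbin N i) ⊕ (neg (qpow e) ⊗ alternate (+ suc i +ℤ z) (qbin N (suc i))) ∎
  where
  open ≋-Reasoning
  w = + i +ℤ z
  index : ∀ i z → (+ 1 +ℤ i) +ℤ (z ℤ.- + 1) ≡ i +ℤ z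
  index = ℤ-Solver.solve-∀
  index′ : ∀ i z → + 1 +ℤ i ≡ (i +ℤ z) +ℤ (ℤ.- z +ℤ + 1)
  index′ = ℤ-Solver.solve-∀
  index″ : ∀ i z → (i +ℤ z) +ℤ + 1 ≡ (+ 1 +ℤ i) +ℤ z
  index″ = ℤ-Solver.solve-∀

alternatingQbinSum-step : ∀ N z e → + e ≡ ℤ.- z +ℤ + 1 →
  alternatingQbinSum (suc N) (z ℤ.- + 1) ≋ (1-q^ e ⊗ alternatingQbinSum N z)
alternatingQbinSum-step N z e e≡1-z = begin
  g 0 ⊕ ∑ (suc N) (g ∘ suc)
    ≈⟨ ⊕-cong (alternate-qbin-head N z e e≡1-z) (∑-cong (suc N) λ i _ → alternate-qbin-pascal N z e i e≡1-z) ⟩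
  (nQ ⊗ h 0) ⊕ ∑ (suc N) (λ i → h i ⊕ (nQ ⊗ h (suc i)))
    ≈⟨ ⊕-congʳ (nQ ⊗ h 0) (∑-⊕ (suc N) h (λ i → nQ ⊗ h (suc i))) ⟩
  (nQ ⊗ h 0) ⊕ (alternatingQbinSum N z ⊕ ∑ (suc N) (λ i → nQ ⊗ h (suc i)))
    ≈⟨ ⊕-congʳ (nQ ⊗ h 0) (⊕-congʳ (alternatingQbinSum N z) (≋-trans (∑-⊗ˡ (suc N) nQ (h ∘ suc)) (⊗-congʳ nQ last-vanishes))) ⟩
  (nQ ⊗ h 0) ⊕ ((h 0 ⊕ ∑ N (h ∘ suc)) ⊕ (nQ ⊗ ∑ N (h ∘ suc)))
    ≈⟨ factor (qpow e) (h 0) (∑ N (h ∘ suc)) ⟩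
  1-q^ e ⊗ alternatingQbinSum N z ∎
  where
  open ≋-Reasoning
  nQ = neg (qpow e)
  g : ℕ → Poly
  g i = alternate (+ i +ℤ (z ℤ.- + 1)) (qbin (suc N) i)
  h : ℕ → Poly
  h i = alternate (+ i +ℤ z) (qbin N i)
  last-vanishes : ∑ (suc N) (h ∘ suc) ≋ ∑ N (h ∘ suc)
  last-vanishes = ≋-trans (∑-suc N (h ∘ suc)) (≋-trans (⊕-congʳ (∑ N (h ∘ suc))
    (≋-trans (signedShift-cong (choose2 w) (sgn w) (k>n⇒qbin≋[] N (suc N) (ℕP.n<1+n N))) (shift-zero (choose2 w))))
    (⊕-identityʳ _))
    where w = + suc N +ℤ z
  factor : ∀ Q h₀ S → ((neg Q ⊗ h₀) ⊕ ((h₀ ⊕ S) ⊕ (neg Q ⊗ S))) ≋ ((one ⊕ neg Q) ⊗ (h₀ ⊕ S))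
  factor = solve-∀ poly-ring

-- Iterating the step from z = −s reaches the factor 1 − q⁰ = 0.
alternatingQbinSum-vanishes : ∀ s d → alternatingQbinSum (s + suc d) (ℤ.- + s) ≋ []
alternatingQbinSum-vanishes zero    d = ≋-trans (alternatingQbinSum-step d (+ 1) 0 refl)
  (⊗-vanishˡ (alternatingQbinSum d (+ 1)) (⊕-inverseʳ one))
alternatingQbinSum-vanishes (suc s) d = begin
  alternatingQbinSum (suc s + suc d) (ℤ.- + suc s)
    ≡⟨ cong (alternatingQbinSum (suc (s + suc d))) (negate-suc (+ s)) ⟩
  alternatingQbinSum (suc (s + suc d)) (ℤ.- + s ℤ.- + 1)
    ≈⟨ alternatingQbinSum-step (s + suc d) (ℤ.- + s) (suc s) (double-negation (+ s)) ⟩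
  1-q^ suc s ⊗ alternatingQbinSum (s + suc d) (ℤ.- + s)
    ≈⟨ ⊗-vanishʳ (1-q^ suc s) (alternatingQbinSum-vanishes s d) ⟩
  [] ∎
  where
  open ≋-Reasoning
  negate-suc : ∀ s → ℤ.- (+ 1 +ℤ s) ≡ ℤ.- s ℤ.- + 1
  negate-suc = ℤ-Solver.solve-∀
  double-negation : ∀ s → + 1 +ℤ s ≡ ℤ.- (ℤ.- s) +ℤ + 1
  double-negation = ℤ-Solver.solve-∀

alternatingCentralTerm : ℕ → ℤ → Poly
alternatingCentralTerm s k = alternate k (qbinᶜ s s k)

alternatingCentralTerm-above : ∀ s κ → s < κ → alternatingCentralTerm s (+ κ) ≋ []
alternatingCentralTerm-above s κ s<κ =
  ≋-trans (signedShift-cong (choose2 (+ κ)) (sgn (+ κ)) (qbinᶜ-above s s κ s<κ)) (shift-zero (choose2 (+ κ)))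

alternatingCentralTerm-below : ∀ s κ → s < κ → alternatingCentralTerm s (ℤ.- + κ) ≋ []
alternatingCentralTerm-below s (suc κ) s<κ = ≋-trans
  (signedShift-cong (choose2 k) (sgn k) (≋-trans (qbinᶜ-comm s s k) (qbinᶜ-above s s (suc κ) s<κ)))
  (shift-zero (choose2 k))
  where k = -[1+ κ ]

polySum-alternatingCentralTerm : ∀ s → polySum s (alternatingCentralTerm s) ≋ alternatingQbinSum (s + s) (ℤ.- + s)
polySum-alternatingCentralTerm s = begin
  polySum s (alternatingCentralTerm s)
    ≡⟨ polySum≡∑ s (alternatingCentralTerm s) ⟩
  ∑ (suc (2 * s)) (λ i → alternatingCentralTerm s (+ i ℤ.- + s))
    ≡⟨ cong (λ n → ∑ (suc (s + n)) (λ i → alternatingCentralTerm s (+ i ℤ.- + s))) (ℕP.+-identityʳ s) ⟩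
  ∑ (suc (s + s)) (λ i → alternatingCentralTerm s (+ i ℤ.- + s))
    ≈⟨ ∑-cong (suc (s + s)) (λ i _ → signedShift-cong (choose2 (+ i ℤ.- + s)) (sgn (+ i ℤ.- + s))
                                          (≡⇒≋ (cong (qbinℤ (s + s)) (recentre (+ s) (+ i))))) ⟩
  alternatingQbinSum (s + s) (ℤ.- + s) ∎
  where
  open ≋-Reasoning
  recentre : ∀ s i → s +ℤ (i ℤ.- s) ≡ i
  recentre = ℤ-Solver.solve-∀

polySum-alternatingCentralTerm-shrink : ∀ s L → s ≤ L →
  polySum L (alternatingCentralTerm s) ≋ alternatingQbinSum (s + s) (ℤ.- + s)
polySum-alternatingCentralTerm-shrink s L s≤L with ℕP.≤⇒≤″ s≤L
... | d , refl = begin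
  polySum (s + d) (alternatingCentralTerm s)  ≡⟨ cong (λ n → polySum n (alternatingCentralTerm s)) (ℕP.+-comm s d) ⟩
  polySum (d + s) (alternatingCentralTerm s)  ≈⟨ polySum-shrink s d (alternatingCentralTerm s)
                                                     (alternatingCentralTerm-above s) (alternatingCentralTerm-below s) ⟩
  polySum s (alternatingCentralTerm s)  ≈⟨ polySum-alternatingCentralTerm s ⟩
  alternatingQbinSum (s + s) (ℤ.- + s)  ∎
  where open ≋-Reasoning

alternatingCentralSum-zero : ∀ L → polySum L (alternatingCentralTerm 0) ≋ one
alternatingCentralSum-zero L = polySum-alternatingCentralTerm-shrink 0 L z≤n

alternatingCentralSum-suc : ∀ s L → suc s ≤ L → polySum L (alternatingCentralTerm (suc s)) ≋ []
alternatingCentralSum-suc s L s<L = ≋-trans (polySum-alternatingCentralTerm-shrink (suc s) L s<L)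
                                            (alternatingQbinSum-vanishes (suc s) s)

-- Nonnegative coefficients

NonNegative : Poly → Set
NonNegative p = ∀ i → 0ℤ ≤ℤ coeff p i

0≤-+ : ∀ {a b} → 0ℤ ≤ℤ a → 0ℤ ≤ℤ b → 0ℤ ≤ℤ a +ℤ b
0≤-+ (+≤+ _) (+≤+ _) = +≤+ z≤n

0≤-* : ∀ {a b} → 0ℤ ≤ℤ a → 0ℤ ≤ℤ b → 0ℤ ≤ℤ a *ℤ b
0≤-* {+ m} {+ n} _ _ = subst (0ℤ ≤ℤ_) (ℤP.pos-* m n) (+≤+ z≤n)


nonNegative-[] : NonNegative []
nonNegative-[] i = +≤+ z≤n

nonNegative-one : NonNegative one
nonNegative-one zero    = +≤+ z≤n
nonNegative-one (suc i) = +≤+ z≤n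

nonNegative-∷ : ∀ {a p} → 0ℤ ≤ℤ a → NonNegative p → NonNegative (a ∷ p)
nonNegative-∷ a≥0 p≥0 zero    = a≥0
nonNegative-∷ a≥0 p≥0 (suc i) = p≥0 i

nonNegative-⊕ : ∀ p r → NonNegative p → NonNegative r → NonNegative (p ⊕ r)
nonNegative-⊕ p r p≥0 r≥0 i = subst (0ℤ ≤ℤ_) (sym (coeff-⊕ p r i)) (0≤-+ (p≥0 i) (r≥0 i))

nonNegative-scale : ∀ c p → 0ℤ ≤ℤ c → NonNegative p → NonNegative (scale c p)
nonNegative-scale c p c≥0 p≥0 i = subst (0ℤ ≤ℤ_) (sym (coeff-scale c p i)) (0≤-* c≥0 (p≥0 i))

nonNegative-⊗ : ∀ p r → NonNegative p → NonNegative r → NonNegative (p ⊗ r)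
nonNegative-⊗ []      r p≥0 r≥0 = nonNegative-[]
nonNegative-⊗ (a ∷ p) r p≥0 r≥0 = nonNegative-⊕ (scale a r) (+ 0 ∷ (p ⊗ r))
  (nonNegative-scale a r (p≥0 0) r≥0)
  (nonNegative-∷ (+≤+ z≤n) (nonNegative-⊗ p r (p≥0 ∘ suc) r≥0))

nonNegative-shift : ∀ e p → NonNegative p → NonNegative (shift e p)
nonNegative-shift zero    p p≥0 = p≥0
nonNegative-shift (suc e) p p≥0 = nonNegative-∷ (+≤+ z≤n) (nonNegative-shift e p p≥0)

nonNegative-qpow : ∀ e → NonNegative (qpow e)
nonNegative-qpow e = nonNegative-shift e one nonNegative-one

nonNegative-qbin : ∀ n k → NonNegative (qbin n k)
nonNegative-qbin n       zero    = nonNegative-one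
nonNegative-qbin zero    (suc k) = nonNegative-[]
nonNegative-qbin (suc n) (suc k) = nonNegative-⊕ (qbin n k) (shift (suc k) (qbin n (suc k)))
  (nonNegative-qbin n k) (nonNegative-shift (suc k) (qbin n (suc k)) (nonNegative-qbin n (suc k)))

nonNegative-∑ : ∀ n f → (∀ i → NonNegative (f i)) → NonNegative (∑ n f)
nonNegative-∑ zero    f f≥0 = nonNegative-[]
nonNegative-∑ (suc n) f f≥0 = nonNegative-⊕ (f 0) (∑ n (f ∘ suc)) (f≥0 0) (nonNegative-∑ n (f ∘ suc) (f≥0 ∘ suc))

nonNegative-contractionWeight : ∀ ε a b s → NonNegative (contractionWeight ε a b s)
nonNegative-contractionWeight true  a b s = nonNegative-qpow (s * s)
nonNegative-contractionWeight false a b s = nonNegative-qpow ((a ∸ s) * (b ∸ s))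

nonNegative⇒natural : ∀ p → NonNegative p → map +_ (map ∣_∣ p) ≈ p
nonNegative⇒natural []      p≥0 i       = refl
nonNegative⇒natural (a ∷ p) p≥0 zero    = ℤP.0≤i⇒+∣i∣≡i (p≥0 0)
nonNegative⇒natural (a ∷ p) p≥0 (suc i) = nonNegative⇒natural p (p≥0 ∘ suc) i

first : List ℕ → ℕ → ℕ
first []      v = v
first (c ∷ _) v = c

cyclePath : ℤ → ℕ → List ℕ → ℕ → Poly
cyclePath k a []       v = qbinᶜ a v k
cyclePath k a (c ∷ cs) v = qbinᶜ a c k ⊗ cyclePath k c cs v

pathTail : ℤ → List ℕ → ℕ → Poly
pathTail k []       v = one
pathTail k (c ∷ cs) v = cyclePath k c cs v

cycleProduct : ℤ → ℕ → List ℕ → ℕ → Poly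
cycleProduct k a ms v = cyclePath k a ms v ⊗ qbinᶜ v a k

cycleSummand : ℕ → ℤ → Poly → Poly
cycleSummand j k = signedShift (j * (∣ k ∣ * ∣ k ∣) + choose2 k) (sgn k)

cycleSum : ℕ → ℕ → ℕ → List ℕ → ℕ → Poly
cycleSum j L a ms v = polySum L λ k → cycleSummand j k (cycleProduct k a ms v)

-- Each contraction introduces a summation variable s; while j > 0 it absorbs
-- one factor q^(k²) and uses the weights q^(s²).
quotient : ℕ → ℕ → List ℕ → ℕ → Poly
quotient j a []       v = contractionWeight (0 <ᵇ j) a v 0
quotient j a (b ∷ ms) v = ∑ (suc (a ⊓ b)) λ s →
  contractionWeight (0 <ᵇ j) a b s ⊗ (qbin a s ⊗ (qbin (b + first ms v) (b ∸ s) ⊗ quotient (pred j) s ms v))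

quotient-nonNegative : ∀ j a ms v → NonNegative (quotient j a ms v)
quotient-nonNegative j a []       v = nonNegative-contractionWeight (0 <ᵇ j) a v 0
quotient-nonNegative j a (b ∷ ms) v = nonNegative-∑ (suc (a ⊓ b)) term λ s →
  nonNegative-⊗ (W s) _ (nonNegative-contractionWeight (0 <ᵇ j) a b s)
    (nonNegative-⊗ (qbin a s) _ (nonNegative-qbin a s)
      (nonNegative-⊗ (qbin (b + first ms v) (b ∸ s)) (quotient (pred j) s ms v)
        (nonNegative-qbin (b + first ms v) (b ∸ s)) (quotient-nonNegative (pred j) s ms v)))
  where
  W = contractionWeight (0 <ᵇ j) a b
  term : ℕ → Poly
  term s = W s ⊗ (qbin a s ⊗ (qbin (b + first ms v) (b ∸ s) ⊗ quotient (pred j) s ms v))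

cycleSummand-pred : ∀ j k p → cycleSummand j k p ≋ cycleSummand (pred j) k (shift (squareIf (0 <ᵇ j) k) p)
cycleSummand-pred zero    k p = ≋-refl
cycleSummand-pred (suc j) k p = begin
  shift ((K + j * K) + c₂) (scale (sgn k) p)      ≡⟨ cong (λ e → shift e (scale (sgn k) p)) (rearrange K j c₂) ⟩
  shift ((j * K + c₂) + K) (scale (sgn k) p)      ≡⟨ shift-+ (j * K + c₂) K (scale (sgn k) p) ⟩
  shift (j * K + c₂) (shift K (scale (sgn k) p))  ≈⟨ shift-cong (j * K + c₂) (scale-shift (sgn k) K p) ⟨
  shift (j * K + c₂) (scale (sgn k) (shift K p))  ∎
  where
  open ≋-Reasoning
  K = ∣ k ∣ * ∣ k ∣
  c₂ = choose2 k
  rearrange : ∀ K j c₂ → (K + j * K) + c₂ ≡ (j * K + c₂) + K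
  rearrange = ℕ-Solver.solve-∀

cyclePath-split : ∀ k a ms v → cyclePath k a ms v ≋ (qbinᶜ a (first ms v) k ⊗ pathTail k ms v)
cyclePath-split k a []       v = ≋-sym (⊗-identityʳ _)
cyclePath-split k a (c ∷ cs) v = ≋-refl

cycleProduct-split : ∀ k s ms v → cycleProduct k s ms v ≋ ((qbinᶜ s (first ms v) k ⊗ qbinᶜ v s k) ⊗ pathTail k ms v)
cycleProduct-split k s ms v = ≋-trans (⊗-congˡ (qbinᶜ v s k) (cyclePath-split k s ms v))
                                      (regroup (qbinᶜ s (first ms v) k) (pathTail k ms v) (qbinᶜ v s k))
  where
  regroup : ∀ b r c → ((b ⊗ r) ⊗ c) ≋ ((b ⊗ c) ⊗ r)
  regroup = solve-∀ poly-ring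

cycleProduct-firstEdge : ∀ k a b ms v →
  cycleProduct k a (b ∷ ms) v ≋ ((qbinᶜ a b k ⊗ (qbinᶜ b (first ms v) k ⊗ qbinᶜ v a k)) ⊗ pathTail k ms v)
cycleProduct-firstEdge k a b ms v =
  ≋-trans (⊗-congˡ (qbinᶜ v a k) (⊗-congʳ (qbinᶜ a b k) (cyclePath-split k b ms v)))
          (regroup (qbinᶜ a b k) (qbinᶜ b (first ms v) k) (pathTail k ms v) (qbinᶜ v a k))
  where
  regroup : ∀ a b r c → ((a ⊗ (b ⊗ r)) ⊗ c) ≋ ((a ⊗ (b ⊗ c)) ⊗ r)
  regroup = solve-∀ poly-ring

cycleSummand-contract : ∀ j k a b ms v →
  cycleSummand j k (cycleProduct k a (b ∷ ms) v)
    ≋ ∑ (suc (a ⊓ b)) (λ s → edgeCoeff (0 <ᵇ j) a b (first ms v) v s ⊗ cycleSummand (pred j) k (cycleProduct k s ms v))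
cycleSummand-contract j k a b ms v = begin
  cycleSummand j k (cycleProduct k a (b ∷ ms) v)
    ≈⟨ cycleSummand-pred j k (cycleProduct k a (b ∷ ms) v) ⟩
  cycleSummand j′ k (shift (squareIf ε k) (cycleProduct k a (b ∷ ms) v))
    ≈⟨ signedShift-cong c σ (shift-cong (squareIf ε k) (cycleProduct-firstEdge k a b ms v)) ⟩
  cycleSummand j′ k (shift (squareIf ε k) (T ⊗ R))
    ≈⟨ signedShift-cong c σ (≋-trans (shift-⊗ (squareIf ε k) T R) (⊗-congˡ R (edge-contraction ε a b u v k))) ⟩
  cycleSummand j′ k (contractedEdge ε a b u v k ⊗ R)
    ≈⟨ signedShift-cong c σ (∑-⊗ʳ M R (λ s → E s ⊗ D s)) ⟨
  cycleSummand j′ k (∑ M (λ s → (E s ⊗ D s) ⊗ R))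
    ≈⟨ signedShift-∑ c σ M (λ s → (E s ⊗ D s) ⊗ R) ⟩
  ∑ M (λ s → cycleSummand j′ k ((E s ⊗ D s) ⊗ R))
    ≈⟨ ∑-cong M (λ s _ → pull-out s) ⟩
  ∑ M (λ s → E s ⊗ cycleSummand j′ k (cycleProduct k s ms v)) ∎
  where
  open ≋-Reasoning
  ε = 0 <ᵇ j
  j′ = pred j
  u = first ms v
  c = j′ * (∣ k ∣ * ∣ k ∣) + choose2 k
  σ = sgn k
  M = suc (a ⊓ b)
  T = qbinᶜ a b k ⊗ (qbinᶜ b u k ⊗ qbinᶜ v a k)
  R = pathTail k ms v
  E = edgeCoeff ε a b u v
  D : ℕ → Poly
  D s = qbinᶜ s u k ⊗ qbinᶜ v s k
  pull-out : ∀ s → cycleSummand j′ k ((E s ⊗ D s) ⊗ R) ≋ (E s ⊗ cycleSummand j′ k (cycleProduct k s ms v))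
  pull-out s = begin
    cycleSummand j′ k ((E s ⊗ D s) ⊗ R)              ≈⟨ signedShift-cong c σ (⊗-assoc (E s) (D s) R) ⟩
    cycleSummand j′ k (E s ⊗ (D s ⊗ R))              ≈⟨ signedShift-⊗ c σ (E s) (D s ⊗ R) ⟩
    E s ⊗ cycleSummand j′ k (D s ⊗ R)                ≈⟨ ⊗-congʳ (E s) (signedShift-cong c σ (cycleProduct-split k s ms v)) ⟨
    E s ⊗ cycleSummand j′ k (cycleProduct k s ms v)  ∎

loopCoeff-zero : ∀ ε a v → loopCoeff ε a v 0 ≋ (qbin (a + v) v ⊗ contractionWeight ε a v 0)
loopCoeff-zero ε a v = begin
  W ⊗ (qbin (a + v) a ⊗ qbin (v + 0) v)  ≈⟨ ⊗-congʳ W (⊗-cong (qbin⁺-comm a v) (≋-trans (≡⇒≋ (cong (λ n → qbin n v) (ℕP.+-identityʳ v))) (qbin-n-n v))) ⟩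
  W ⊗ (qbin (v + a) v ⊗ one)             ≈⟨ ⊗-congʳ W (⊗-identityʳ _) ⟩
  W ⊗ qbin (v + a) v                     ≡⟨ cong (λ n → W ⊗ qbin n v) (ℕP.+-comm v a) ⟩
  W ⊗ qbin (a + v) v                     ≈⟨ ⊗-comm W (qbin (a + v) v) ⟩
  qbin (a + v) v ⊗ W                     ∎
  where
  open ≋-Reasoning
  W = contractionWeight ε a v 0

loopSum : ∀ ε L a v → a ≤ L →
  polySum L (λ k → alternate k (loopProduct ε a v k)) ≋ (qbin (a + v) v ⊗ contractionWeight ε a v 0)
loopSum ε L a v a≤L = begin
  polySum L (λ k → alternate k (loopProduct ε a v k))
    ≈⟨ polySum-cong L (λ k → signedShift-cong (choose2 k) (sgn k) (loop-contraction ε a v k)) ⟩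
  polySum L (λ k → alternate k (contractedLoop ε a v k))
    ≈⟨ polySum-cong L (λ k → ≋-trans (signedShift-∑ (choose2 k) (sgn k) M (λ s → lc s ⊗ qbinᶜ s s k))
                                     (∑-cong M λ s _ → signedShift-⊗ (choose2 k) (sgn k) (lc s) (qbinᶜ s s k))) ⟩
  polySum L (λ k → ∑ M (λ s → lc s ⊗ alternatingCentralTerm s k))
    ≈⟨ polySum-∑-comm L M (λ k s → lc s ⊗ alternatingCentralTerm s k) ⟩
  ∑ M (λ s → polySum L (λ k → lc s ⊗ alternatingCentralTerm s k))
    ≈⟨ ∑-cong M (λ s _ → polySum-⊗ˡ L (lc s) (alternatingCentralTerm s)) ⟩
  (lc 0 ⊗ polySum L (alternatingCentralTerm 0)) ⊕ ∑ (a ⊓ v) (λ s → lc (suc s) ⊗ polySum L (alternatingCentralTerm (suc s)))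
    ≈⟨ ⊕-cong (⊗-congʳ (lc 0) (alternatingCentralSum-zero L))
              (∑-zero (a ⊓ v) λ s s<m → ⊗-vanishʳ (lc (suc s))
                 (alternatingCentralSum-suc s L (ℕP.≤-trans s<m (ℕP.≤-trans (ℕP.m⊓n≤m a v) a≤L)))) ⟩
  (lc 0 ⊗ one) ⊕ []
    ≈⟨ ≋-trans (⊕-identityʳ _) (⊗-identityʳ (lc 0)) ⟩
  lc 0
    ≈⟨ loopCoeff-zero ε a v ⟩
  qbin (a + v) v ⊗ contractionWeight ε a v 0 ∎
  where
  open ≋-Reasoning
  M = suc (a ⊓ v)
  lc = loopCoeff ε a v

quotient-revision : ∀ a v s → s ≤ a → (qbin (v + a) (a ∸ s) ⊗ qbin (s + v) v) ≋ (qbin (a + v) v ⊗ qbin a s)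
quotient-revision a v s s≤a with ℕP.≤⇒≤″ s≤a
... | α , refl = begin
  qbin (v + (s + α)) ((s + α) ∸ s) ⊗ qbin (s + v) v
    ≈⟨ ⊗-cong (qbin≡qbin⁺ α (s + v) (e₁ s α v) (ℕP.m+n∸m≡n s α)) (≋-trans (qbin≡qbin⁺ v s (ℕP.+-comm s v) refl) (qbin⁺-comm v s)) ⟩
  qbin⁺ α (s + v) ⊗ qbin⁺ s v
    ≈⟨ qbin⁺-trinomial α s v ⟩
  qbin⁺ (α + s) v ⊗ qbin⁺ α s
    ≈⟨ ⊗-cong (≋-trans (qbin≡qbin⁺ v (α + s) (e₂ s α v) refl) (qbin⁺-comm v (α + s))) (qbin⁺-comm s α) ⟨
  qbin ((s + α) + v) v ⊗ qbin (s + α) s ∎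
  where
  open ≋-Reasoning
  e₁ : ∀ s α v → v + (s + α) ≡ α + (s + v)
  e₁ = ℕ-Solver.solve-∀
  e₂ : ∀ s α v → (s + α) + v ≡ v + (α + s)
  e₂ = ℕ-Solver.solve-∀

edgeCoeff-absorb : ∀ ε a b u v s R → s ≤ a →
  (edgeCoeff ε a b u v s ⊗ (qbin (s + v) v ⊗ R))
    ≋ (qbin (a + v) v ⊗ (contractionWeight ε a b s ⊗ (qbin a s ⊗ (qbin (b + u) (b ∸ s) ⊗ R))))
edgeCoeff-absorb ε a b u v s R s≤a = begin
  (W ⊗ (B ⊗ A)) ⊗ (qbin (s + v) v ⊗ R)         ≈⟨ regroup₁ W B A (qbin (s + v) v) R ⟩
  W ⊗ (B ⊗ ((A ⊗ qbin (s + v) v) ⊗ R))         ≈⟨ ⊗-congʳ W (⊗-congʳ B (⊗-congˡ R (quotient-revision a v s s≤a))) ⟩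
  W ⊗ (B ⊗ ((qbin (a + v) v ⊗ qbin a s) ⊗ R))  ≈⟨ regroup₂ W B (qbin (a + v) v) (qbin a s) R ⟩
  qbin (a + v) v ⊗ (W ⊗ (qbin a s ⊗ (B ⊗ R)))  ∎
  where
  open ≋-Reasoning
  W = contractionWeight ε a b s
  B = qbin (b + u) (b ∸ s)
  A = qbin (v + a) (a ∸ s)
  regroup₁ : ∀ w b a p r → ((w ⊗ (b ⊗ a)) ⊗ (p ⊗ r)) ≋ (w ⊗ (b ⊗ ((a ⊗ p) ⊗ r)))
  regroup₁ = solve-∀ poly-ring
  regroup₂ : ∀ w b f x r → (w ⊗ (b ⊗ ((f ⊗ x) ⊗ r))) ≋ (f ⊗ (w ⊗ (x ⊗ (b ⊗ r))))
  regroup₂ = solve-∀ poly-ring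

cycleSum-factorisation : ∀ ms j a v L → j ≤ suc (length ms) → a ≤ L →
  cycleSum j L a ms v ≋ (qbin (a + v) v ⊗ quotient j a ms v)
cycleSum-factorisation []       zero          a v L _         a≤L = loopSum false L a v a≤L
cycleSum-factorisation []       (suc zero)    a v L _         a≤L =
  ≋-trans (polySum-cong L λ k → cycleSummand-pred 1 k (cycleProduct k a [] v)) (loopSum true L a v a≤L)
cycleSum-factorisation []       (suc (suc j)) a v L (s≤s ())  a≤L
cycleSum-factorisation (b ∷ ms) j             a v L j≤2+len   a≤L = begin
  cycleSum j L a (b ∷ ms) v
    ≈⟨ polySum-cong L (λ k → cycleSummand-contract j k a b ms v) ⟩
  polySum L (λ k → ∑ M (λ s → E s ⊗ cycleSummand j′ k (cycleProduct k s ms v)))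
    ≈⟨ polySum-∑-comm L M (λ k s → E s ⊗ cycleSummand j′ k (cycleProduct k s ms v)) ⟩
  ∑ M (λ s → polySum L (λ k → E s ⊗ cycleSummand j′ k (cycleProduct k s ms v)))
    ≈⟨ ∑-cong M (λ s _ → polySum-⊗ˡ L (E s) (λ k → cycleSummand j′ k (cycleProduct k s ms v))) ⟩
  ∑ M (λ s → E s ⊗ cycleSum j′ L s ms v)
    ≈⟨ ∑-cong M term ⟩
  ∑ M (λ s → qbin (a + v) v ⊗ Q s)
    ≈⟨ ∑-⊗ˡ M (qbin (a + v) v) Q ⟩
  qbin (a + v) v ⊗ quotient j a (b ∷ ms) v ∎
  where
  open ≋-Reasoning
  ε = 0 <ᵇ j
  j′ = pred j
  u = first ms v
  M = suc (a ⊓ b)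
  E = edgeCoeff ε a b u v
  Q : ℕ → Poly
  Q s = contractionWeight ε a b s ⊗ (qbin a s ⊗ (qbin (b + u) (b ∸ s) ⊗ quotient j′ s ms v))
  term : ∀ s → s < M → (E s ⊗ cycleSum j′ L s ms v) ≋ (qbin (a + v) v ⊗ Q s)
  term s s<M = ≋-trans
    (⊗-congʳ (E s) (cycleSum-factorisation ms j′ s v L (ℕP.∸-monoˡ-≤ 1 j≤2+len) (ℕP.≤-trans s≤a a≤L)))
    (edgeCoeff-absorb ε a b u v s (quotient j′ s ms v) s≤a)
    where
    s≤a = ℕP.≤-trans (ℕP.≤-pred s<M) (ℕP.m⊓n≤m a b)

-- interior vertices of the cycle l → m → n → l → ⋯ → n → l winding r + 1 times
tripleCycle : ℕ → ℕ → ℕ → ℕ → List ℕ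
tripleCycle l m n zero    = m ∷ []
tripleCycle l m n (suc r) = m ∷ n ∷ l ∷ tripleCycle l m n r

length-tripleCycle : ∀ l m n r → length (tripleCycle l m n r) ≡ suc (3 * r)
length-tripleCycle l m n zero    = refl
length-tripleCycle l m n (suc r) = trans (cong (λ x → 3 + x) (length-tripleCycle l m n r)) (arithmetic r)
  where
  arithmetic : ∀ r → 3 + suc (3 * r) ≡ suc (3 * suc r)
  arithmetic = ℕ-Solver.solve-∀

cycleProduct-tripleCycle : ∀ k l m n r →
  cycleProduct k l (tripleCycle l m n r) n ≋ (((qbinᶜ l m k ⊗ qbinᶜ m n k) ⊗ qbinᶜ n l k) ^ᵖ suc r)
cycleProduct-tripleCycle k l m n zero    = ≋-sym (⊗-identityʳ _)
cycleProduct-tripleCycle k l m n (suc r) =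
  ≋-trans (regroup (qbinᶜ l m k) (qbinᶜ m n k) (qbinᶜ n l k) (cyclePath k l (tripleCycle l m n r) n))
          (⊗-congʳ ((qbinᶜ l m k ⊗ qbinᶜ m n k) ⊗ qbinᶜ n l k) (cycleProduct-tripleCycle k l m n r))
  where
  regroup : ∀ a b c p → ((a ⊗ (b ⊗ (c ⊗ p))) ⊗ c) ≋ (((a ⊗ b) ⊗ c) ⊗ (p ⊗ c))
  regroup = solve-∀ poly-ring

qSum≋cycleSum : ∀ l m n r j → qSum l m n (suc r) j ≋ cycleSum j l l (tripleCycle l m n r) n
qSum≋cycleSum l m n r j = polySum-cong l λ k →
  signedShift-cong (j * (∣ k ∣ * ∣ k ∣) + choose2 k) (sgn k) (≋-sym (begin
    cycleProduct k l (tripleCycle l m n r) n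
      ≈⟨ cycleProduct-tripleCycle k l m n r ⟩
    ((qbinᶜ l m k ⊗ qbinᶜ m n k) ⊗ qbinᶜ n l k) ^ᵖ suc r
      ≈⟨ ^ᵖ-distrib-⊗ (qbinᶜ l m k ⊗ qbinᶜ m n k) (qbinᶜ n l k) (suc r) ⟩
    ((qbinᶜ l m k ⊗ qbinᶜ m n k) ^ᵖ suc r) ⊗ (qbinᶜ n l k ^ᵖ suc r)
      ≈⟨ ⊗-congˡ (qbinᶜ n l k ^ᵖ suc r) (^ᵖ-distrib-⊗ (qbinᶜ l m k) (qbinᶜ m n k) (suc r)) ⟩
    ((qbinᶜ l m k ^ᵖ suc r) ⊗ (qbinᶜ m n k ^ᵖ suc r)) ⊗ (qbinᶜ n l k ^ᵖ suc r) ∎))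
  where open ≋-Reasoning

qSum-factorisation : ∀ l m n r j → j < 3 * suc r →
  qSum l m n (suc r) j ≋ (qbin (l + n) n ⊗ quotient j l (tripleCycle l m n r) n)
qSum-factorisation l m n r j j<3r+3 = ≋-trans (qSum≋cycleSum l m n r j)
  (cycleSum-factorisation (tripleCycle l m n r) j l n l j≤len ℕP.≤-refl)
  where
  j≤len : j ≤ suc (length (tripleCycle l m n r))
  j≤len rewrite length-tripleCycle l m n r = ℕP.≤-pred (ℕP.≤-trans j<3r+3 (ℕP.≤-reflexive (arithmetic r)))
    where
    arithmetic : ∀ r → 3 * suc r ≡ suc (suc (suc (3 * r)))
    arithmetic = ℕ-Solver.solve-∀

qSum-nonNegativeQuotient : ∀ l m n r j → j < 3 * suc r →
  Σ (List ℕ) λ P → qbin (l + n) n ⊗ map +_ P ≈ qSum l m n (suc r) j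
qSum-nonNegativeQuotient l m n r j j<3r+3 = map ∣_∣ Q , coeff-≡ (begin
  qbin (l + n) n ⊗ map +_ (map ∣_∣ Q)  ≈⟨ ⊗-congʳ (qbin (l + n) n) (mk (nonNegative⇒natural Q (quotient-nonNegative j l cycle n))) ⟩
  qbin (l + n) n ⊗ Q                   ≈⟨ qSum-factorisation l m n r j j<3r+3 ⟨
  qSum l m n (suc r) j                 ∎)
  where
  open ≋-Reasoning
  cycle = tripleCycle l m n r
  Q = quotient j l cycle n

-- Specialisation to q = 1

evalAt1 : Poly → ℤ
evalAt1 []      = + 0
evalAt1 (a ∷ p) = a +ℤ evalAt1 p

evalAt1-⊕ : ∀ p r → evalAt1 (p ⊕ r) ≡ evalAt1 p +ℤ evalAt1 r
evalAt1-⊕ []      r       = sym (ℤP.+-identityˡ _)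
evalAt1-⊕ (a ∷ p) []      = sym (ℤP.+-identityʳ _)
evalAt1-⊕ (a ∷ p) (b ∷ r) = trans (cong ((a +ℤ b) +ℤ_) (evalAt1-⊕ p r)) (+-interchange a b (evalAt1 p) (evalAt1 r))

evalAt1-scale : ∀ c p → evalAt1 (scale c p) ≡ c *ℤ evalAt1 p
evalAt1-scale c []      = sym (ℤP.*-zeroʳ c)
evalAt1-scale c (a ∷ p) = trans (cong (c *ℤ a +ℤ_) (evalAt1-scale c p)) (sym (ℤP.*-distribˡ-+ c a (evalAt1 p)))

evalAt1-⊗ : ∀ p r → evalAt1 (p ⊗ r) ≡ evalAt1 p *ℤ evalAt1 r
evalAt1-⊗ []      r = refl
evalAt1-⊗ (a ∷ p) r = begin
  evalAt1 (scale a r ⊕ (+ 0 ∷ (p ⊗ r)))              ≡⟨ evalAt1-⊕ (scale a r) (+ 0 ∷ (p ⊗ r)) ⟩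
  evalAt1 (scale a r) +ℤ (+ 0 +ℤ evalAt1 (p ⊗ r))    ≡⟨ cong₂ (λ x y → x +ℤ (+ 0 +ℤ y)) (evalAt1-scale a r) (evalAt1-⊗ p r) ⟩
  a *ℤ evalAt1 r +ℤ (+ 0 +ℤ evalAt1 p *ℤ evalAt1 r)  ≡⟨ distrib a (evalAt1 p) (evalAt1 r) ⟩
  (a +ℤ evalAt1 p) *ℤ evalAt1 r                      ∎
  where
  open ≡-Reasoning
  distrib : ∀ a x y → a *ℤ y +ℤ (+ 0 +ℤ x *ℤ y) ≡ (a +ℤ x) *ℤ y
  distrib = ℤ-Solver.solve-∀

evalAt1-shift : ∀ e p → evalAt1 (shift e p) ≡ evalAt1 p
evalAt1-shift zero    p = refl
evalAt1-shift (suc e) p = trans (ℤP.+-identityˡ _) (evalAt1-shift e p)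

evalAt1-^ᵖ : ∀ p r → evalAt1 (p ^ᵖ r) ≡ evalAt1 p ℤ.^ r
evalAt1-^ᵖ p zero    = refl
evalAt1-^ᵖ p (suc r) = trans (evalAt1-⊗ p (p ^ᵖ r)) (cong (evalAt1 p *ℤ_) (evalAt1-^ᵖ p r))

evalAt1-vanishing : ∀ p → p ≋ [] → evalAt1 p ≡ + 0
evalAt1-vanishing []      e = refl
evalAt1-vanishing (a ∷ p) e = cong₂ _+ℤ_ (coeff-≡ e 0) (evalAt1-vanishing p (∷-zero-tail e))

evalAt1-cong : ∀ p r → p ≋ r → evalAt1 p ≡ evalAt1 r
evalAt1-cong []      r       e = sym (evalAt1-vanishing r (≋-sym e))
evalAt1-cong (a ∷ p) []      e = evalAt1-vanishing (a ∷ p) e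
evalAt1-cong (a ∷ p) (b ∷ r) e = cong₂ _+ℤ_ (∷-injectiveˡ e) (evalAt1-cong p r (∷-injectiveʳ e))

evalAt1-qbin : ∀ n k → evalAt1 (qbin n k) ≡ + (n C k)
evalAt1-qbin n       zero    = refl
evalAt1-qbin zero    (suc k) = refl
evalAt1-qbin (suc n) (suc k) = begin
  evalAt1 (qbin n k ⊕ shift (suc k) (qbin n (suc k)))             ≡⟨ evalAt1-⊕ (qbin n k) (shift (suc k) (qbin n (suc k))) ⟩
  evalAt1 (qbin n k) +ℤ evalAt1 (shift (suc k) (qbin n (suc k)))  ≡⟨ cong₂ _+ℤ_ (evalAt1-qbin n k) (trans (evalAt1-shift (suc k) _) (evalAt1-qbin n (suc k))) ⟩
  + (n C k + n C suc k)                                           ≡⟨ cong +_ (nCk+nC[k+1]≡[n+1]C[k+1] n k) ⟩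
  + (suc n C suc k)                                               ∎
  where open ≡-Reasoning

evalAt1-qbinℤ : ∀ n k → evalAt1 (qbinℤ n k) ≡ binℤ n k
evalAt1-qbinℤ n (+ k)    = evalAt1-qbin n k
evalAt1-qbinℤ n -[1+ k ] = refl

evalAt1-polySum : ∀ L f → evalAt1 (polySum L f) ≡ intSum L (λ k → evalAt1 (f k))
evalAt1-polySum L f =
  foldr-fusion evalAt1 {λ i acc → f (+ i ℤ.- + L) ⊕ acc} {λ i acc → evalAt1 (f (+ i ℤ.- + L)) +ℤ acc} []
               (λ i acc → evalAt1-⊕ (f (+ i ℤ.- + L)) acc) (upTo (suc (2 * L)))

intSum-cong : ∀ L {f g} → (∀ k → f k ≡ g k) → intSum L f ≡ intSum L g
intSum-cong L {f} {g} f≗g =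
  foldr-cong {f = λ i acc → f (+ i ℤ.- + L) +ℤ acc} {g = λ i acc → g (+ i ℤ.- + L) +ℤ acc}
             (λ i acc → cong (_+ℤ acc) (f≗g (+ i ℤ.- + L))) refl (upTo (suc (2 * L)))

evalAt1-qSum : ∀ l m n r j → evalAt1 (qSum l m n r j) ≡ iSum l m n r
evalAt1-qSum l m n r j = trans (evalAt1-polySum l term) (intSum-cong l evalAt1-term)
  where
  P₁ P₂ P₃ : ℤ → Poly
  P₁ k = qbinℤ (l + m) (+ l +ℤ k) ^ᵖ r
  P₂ k = qbinℤ (m + n) (+ m +ℤ k) ^ᵖ r
  P₃ k = qbinℤ (n + l) (+ n +ℤ k) ^ᵖ r
  term : ℤ → Poly
  term k = shift (j * (∣ k ∣ * ∣ k ∣) + choose2 k) (scale (sgn k) ((P₁ k ⊗ P₂ k) ⊗ P₃ k))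
  power : ∀ N k → evalAt1 (qbinℤ N k ^ᵖ r) ≡ binℤ N k ℤ.^ r
  power N k = trans (evalAt1-^ᵖ (qbinℤ N k) r) (cong (ℤ._^ r) (evalAt1-qbinℤ N k))
  evalAt1-term : ∀ k → evalAt1 (term k)
    ≡ sgn k *ℤ ((binℤ (l + m) (+ l +ℤ k) ℤ.^ r) *ℤ (binℤ (m + n) (+ m +ℤ k) ℤ.^ r) *ℤ (binℤ (n + l) (+ n +ℤ k) ℤ.^ r))
  evalAt1-term k = begin
    evalAt1 (term k)                                                                                                  ≡⟨ evalAt1-shift (j * (∣ k ∣ * ∣ k ∣) + choose2 k) _ ⟩
    evalAt1 (scale (sgn k) ((P₁ k ⊗ P₂ k) ⊗ P₃ k))                                                                    ≡⟨ evalAt1-scale (sgn k) ((P₁ k ⊗ P₂ k) ⊗ P₃ k) ⟩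
    sgn k *ℤ evalAt1 ((P₁ k ⊗ P₂ k) ⊗ P₃ k)                                                                           ≡⟨ cong (sgn k *ℤ_) (evalAt1-⊗ (P₁ k ⊗ P₂ k) (P₃ k)) ⟩
    sgn k *ℤ (evalAt1 (P₁ k ⊗ P₂ k) *ℤ evalAt1 (P₃ k))                                                                ≡⟨ cong (λ x → sgn k *ℤ (x *ℤ evalAt1 (P₃ k))) (evalAt1-⊗ (P₁ k) (P₂ k)) ⟩
    sgn k *ℤ (evalAt1 (P₁ k) *ℤ evalAt1 (P₂ k) *ℤ evalAt1 (P₃ k))                                                     ≡⟨ cong (sgn k *ℤ_) (cong₂ _*ℤ_ (cong₂ _*ℤ_ (power (l + m) (+ l +ℤ k)) (power (m + n) (+ m +ℤ k))) (power (n + l) (+ n +ℤ k))) ⟩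
    sgn k *ℤ ((binℤ (l + m) (+ l +ℤ k) ℤ.^ r) *ℤ (binℤ (m + n) (+ m +ℤ k) ℤ.^ r) *ℤ (binℤ (n + l) (+ n +ℤ k) ℤ.^ r))  ∎
    where open ≡-Reasoning

centredSummand : ℕ → ℕ → ℕ → ℕ → ℤ → Poly
centredSummand l m n r k = alternate k (((qbinᶜ l m k ^ᵖ r) ⊗ (qbinᶜ m n k ^ᵖ r)) ⊗ (qbinᶜ n l k ^ᵖ r))

below-⊓ : ∀ l m n κ → l ⊓ (m ⊓ n) < κ → (l < κ ⊎ m < κ) ⊎ n < κ
below-⊓ l m n κ μ<κ with l ℕ.<? κ | m ℕ.<? κ | n ℕ.<? κ
... | yes l<κ | _       | _       = inj₁ (inj₁ l<κ)
... | no _    | yes m<κ | _       = inj₁ (inj₂ m<κ)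
... | no _    | no _    | yes n<κ = inj₂ n<κ
... | no l≮κ  | no m≮κ  | no n≮κ  =
  ⊥-elim (ℕP.<⇒≱ μ<κ (ℕP.⊓-glb (ℕP.≮⇒≥ l≮κ) (ℕP.⊓-glb (ℕP.≮⇒≥ m≮κ) (ℕP.≮⇒≥ n≮κ))))

centredSummand-vanishes : ∀ l m n r k → (qbinᶜ l m k ≋ [] ⊎ qbinᶜ m n k ≋ []) ⊎ qbinᶜ n l k ≋ [] →
                          centredSummand l m n (suc r) k ≋ []
centredSummand-vanishes l m n r k factor≋[] =
  ≋-trans (signedShift-cong (choose2 k) (sgn k) (product≋[] factor≋[])) (shift-zero (choose2 k))
  where
  X = qbinᶜ l m k ^ᵖ suc r
  Y = qbinᶜ m n k ^ᵖ suc r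
  Z = qbinᶜ n l k ^ᵖ suc r
  product≋[] : (qbinᶜ l m k ≋ [] ⊎ qbinᶜ m n k ≋ []) ⊎ qbinᶜ n l k ≋ [] → ((X ⊗ Y) ⊗ Z) ≋ []
  product≋[] (inj₁ (inj₁ e)) = ⊗-vanishˡ Z (⊗-vanishˡ Y (⊗-vanishˡ (qbinᶜ l m k ^ᵖ r) e))
  product≋[] (inj₁ (inj₂ e)) = ⊗-vanishˡ Z (⊗-vanishʳ X (⊗-vanishˡ (qbinᶜ m n k ^ᵖ r) e))
  product≋[] (inj₂ e)        = ⊗-vanishʳ (X ⊗ Y) (⊗-vanishˡ (qbinᶜ n l k ^ᵖ r) e)

centredSummand-above : ∀ l m n r κ → l ⊓ (m ⊓ n) < κ → centredSummand l m n (suc r) (+ κ) ≋ []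
centredSummand-above l m n r κ μ<κ = centredSummand-vanishes l m n r (+ κ) (vanishing (below-⊓ l m n κ μ<κ))
  where
  vanishing : (l < κ ⊎ m < κ) ⊎ n < κ → (qbinᶜ l m (+ κ) ≋ [] ⊎ qbinᶜ m n (+ κ) ≋ []) ⊎ qbinᶜ n l (+ κ) ≋ []
  vanishing (inj₁ (inj₁ l<κ)) = inj₂ (qbinᶜ-above n l κ l<κ)
  vanishing (inj₁ (inj₂ m<κ)) = inj₁ (inj₁ (qbinᶜ-above l m κ m<κ))
  vanishing (inj₂ n<κ)        = inj₁ (inj₂ (qbinᶜ-above m n κ n<κ))

centredSummand-below : ∀ l m n r κ → l ⊓ (m ⊓ n) < κ → centredSummand l m n (suc r) (ℤ.- + κ) ≋ []
centredSummand-below l m n r (suc κ) μ<κ = centredSummand-vanishes l m n r k (vanishing (below-⊓ l m n (suc κ) μ<κ))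
  where
  k = -[1+ κ ]
  reflected : ∀ x y → x < suc κ → qbinᶜ x y k ≋ []
  reflected x y x<κ = ≋-trans (qbinᶜ-comm x y k) (qbinᶜ-above y x (suc κ) x<κ)
  vanishing : (l < suc κ ⊎ m < suc κ) ⊎ n < suc κ → (qbinᶜ l m k ≋ [] ⊎ qbinᶜ m n k ≋ []) ⊎ qbinᶜ n l k ≋ []
  vanishing (inj₁ (inj₁ l<κ)) = inj₁ (inj₁ (reflected l m l<κ))
  vanishing (inj₁ (inj₂ m<κ)) = inj₁ (inj₂ (reflected m n m<κ))
  vanishing (inj₂ n<κ)        = inj₂ (reflected n l n<κ)

qSum-shrink : ∀ l m n r → qSum l m n (suc r) 0 ≋ polySum (l ⊓ (m ⊓ n)) (centredSummand l m n (suc r))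
qSum-shrink l m n r = begin
  polySum l (centredSummand l m n (suc r))              ≡⟨ cong (λ L → polySum L (centredSummand l m n (suc r))) (ℕP.m∸n+n≡m (ℕP.m⊓n≤m l (m ⊓ n))) ⟨
  polySum ((l ∸ μ) + μ) (centredSummand l m n (suc r))  ≈⟨ polySum-shrink μ (l ∸ μ) (centredSummand l m n (suc r)) (centredSummand-above l m n r) (centredSummand-below l m n r) ⟩
  polySum μ (centredSummand l m n (suc r))              ∎
  where
  open ≋-Reasoning
  μ = l ⊓ (m ⊓ n)

qSum-rotate : ∀ l m n r → qSum l m n (suc r) 0 ≋ qSum m n l (suc r) 0
qSum-rotate l m n r = begin
  qSum l m n (suc r) 0                                  ≈⟨ qSum-shrink l m n r ⟩
  polySum (l ⊓ (m ⊓ n)) (centredSummand l m n (suc r))  ≈⟨ polySum-cong (l ⊓ (m ⊓ n)) rotate ⟩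
  polySum (l ⊓ (m ⊓ n)) (centredSummand m n l (suc r))  ≡⟨ cong (λ L → polySum L (centredSummand m n l (suc r))) (trans (ℕP.⊓-comm l (m ⊓ n)) (ℕP.⊓-assoc m n l)) ⟩
  polySum (m ⊓ (n ⊓ l)) (centredSummand m n l (suc r))  ≈⟨ qSum-shrink m n l r ⟨
  qSum m n l (suc r) 0                                  ∎
  where
  open ≋-Reasoning
  cycle : ∀ x y z → ((x ⊗ y) ⊗ z) ≋ ((y ⊗ z) ⊗ x)
  cycle = solve-∀ poly-ring
  rotate : ∀ k → centredSummand l m n (suc r) k ≋ centredSummand m n l (suc r) k
  rotate k = signedShift-cong (choose2 k) (sgn k) (cycle (qbinᶜ l m k ^ᵖ suc r) (qbinᶜ m n k ^ᵖ suc r) (qbinᶜ n l k ^ᵖ suc r))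

iSum-rotate : ∀ l m n r → iSum l m n (suc r) ≡ iSum m n l (suc r)
iSum-rotate l m n r = begin
  iSum l m n (suc r)              ≡⟨ evalAt1-qSum l m n (suc r) 0 ⟨
  evalAt1 (qSum l m n (suc r) 0)  ≡⟨ evalAt1-cong (qSum l m n (suc r) 0) (qSum m n l (suc r) 0) (qSum-rotate l m n r) ⟩
  evalAt1 (qSum m n l (suc r) 0)  ≡⟨ evalAt1-qSum m n l (suc r) 0 ⟩
  iSum m n l (suc r)              ∎
  where open ≡-Reasoning

binomial-divides-iSum : ∀ l m n r → + ((n + l) C n) ∣ iSum l m n (suc r)
binomial-divides-iSum l m n r =
  subst (+ ((n + l) C n) ∣_) value (Signed.∣⇒∣ᵤ (Signed.∣m⇒∣m*n (evalAt1 Q) (Signed.∣-refl {+ ((n + l) C n)})))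
  where
  open ≡-Reasoning
  Q = quotient 0 l (tripleCycle l m n r) n
  value : + ((n + l) C n) *ℤ evalAt1 Q ≡ iSum l m n (suc r)
  value = begin
    + ((n + l) C n) *ℤ evalAt1 Q           ≡⟨ cong (λ x → + (x C n) *ℤ evalAt1 Q) (ℕP.+-comm n l) ⟩
    + ((l + n) C n) *ℤ evalAt1 Q           ≡⟨ cong (_*ℤ evalAt1 Q) (evalAt1-qbin (l + n) n) ⟨
    evalAt1 (qbin (l + n) n) *ℤ evalAt1 Q  ≡⟨ evalAt1-⊗ (qbin (l + n) n) Q ⟨
    evalAt1 (qbin (l + n) n ⊗ Q)           ≡⟨ evalAt1-cong (qSum l m n (suc r) 0) (qbin (l + n) n ⊗ Q) (qSum-factorisation l m n r 0 (s≤s z≤n)) ⟨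
    evalAt1 (qSum l m n (suc r) 0)         ≡⟨ evalAt1-qSum l m n (suc r) 0 ⟩
    iSum l m n (suc r)                     ∎

corollary4p4 : (l m n r : ℕ) → 1 ≤ l → 1 ≤ m → 1 ≤ n → 1 ≤ r →
    ((j : ℕ) → j < 3 * r →
      Σ (List ℕ) (λ P → qbin (l + n) n ⊗ map +_ P ≈ qSum l m n r j))
    × ((+ ((l + m) C l) ∣ iSum l m n r)
      × (+ ((m + n) C m) ∣ iSum l m n r)
      × (+ ((n + l) C n) ∣ iSum l m n r))
corollary4p4 l m n (suc r) _ _ _ _ =
    qSum-nonNegativeQuotient l m n r
  , subst (+ ((l + m) C l) ∣_) (sym (iSum-rotate l m n r)) (binomial-divides-iSum m n l r)
  , subst (+ ((m + n) C m) ∣_) (sym (trans (iSum-rotate l m n r) (iSum-rotate m n l r))) (binomial-divides-iSum n l m r)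
  , binomial-divides-iSum l m n r
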